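{- For every integer $N\ge1$ and all integers $m,n\ge0$ there is a bijection $$\phi_{2N}:\mathcal{D}_{2N}(m,n)\to \mathcal{D}_{2N-3}(m,n-2m)\cup\mathcal{D}_{2N-3}(m-1,n-2m+1)\cup\mathcal{D}_{2N-3}(m-2,n-2m+2).$$ In particular, $$D_{2N}(m,n)=D_{2N-3}(m,n-2m)+D_{2N-3}(m-1,n-2m+1)+D_{2N-3}(m-2,n-2m+2),$$ and $$d_{2N}(x)=(1+xq+x^2q^2)\,d_{2N-3}(xq^2).$$
   Context: A Schur partition is a partition of an integer into positive parts such that consecutive parts differ by at least $3$, and no two consecutive parts differing by exactly $3$ are both multiples of $3$. For a partition $\pi$, $m(\pi)$ is the number of parts of $\pi$ plus the number of even parts of $\pi$. For an integer $M$, $\mathcal{D}_M(m,n)$ is the set of Schur partitions $\pi$ of $n$ with $m(\pi)=m$ and all parts $\le M$ (for $M\le 0$ only the empty partition qualifies); sets with a negative index are empty. $D_M(m,n)=|\mathcal{D}_M(m,n)|$, and the Alladi–Schur polynomial is $d_M(x)=\sum_{m,n\ge0}D_M(m,n)x^mq^n$ (so $d_{ -1}(x)=1$). -}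

module Defs where

open import Data.Bool using (if_then_else_)
open import Data.Nat as ℕ using (ℕ; zero; suc; _+_; _*_; _∸_)
open import Data.Nat.Divisibility using (_∣_; _∣?_)
open import Data.Integer as ℤ using (ℤ; +_)
open import Data.List using (List; []; _∷_; _++_; length; filter; map; downFrom)
open import Data.Nat.ListAction using (sum)
open import Data.List.Relation.Unary.All using (All; all?)
open import Data.List.Relation.Unary.Linked using (Linked; linked?)
open import Data.Product using (Σ; _×_)
open import Relation.Binary.PropositionalEquality using (_≡_)
open import Relation.Nullary using (Dec; ¬_)
open import Relation.Nullary.Decidable using (True; _×-dec_; ¬?; ⌊_⌋)

-- A partition is represented by the list of its parts in decreasing order.

SchurGap : ℕ → ℕ → Set
SchurGap a b = (b + 3 ℕ.≤ a) × ¬ ((a ≡ b + 3) × ((3 ∣ a) × (3 ∣ b)))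

schurGap? : (a b : ℕ) → Dec (SchurGap a b)
schurGap? a b = (b + 3 ℕ.≤? a) ×-dec ¬? ((a ℕ.≟ b + 3) ×-dec ((3 ∣? a) ×-dec (3 ∣? b)))

-- Schur partition: positive parts, consecutive parts satisfy SchurGap
-- (which in particular forces the list to be strictly decreasing).
IsSchur : List ℕ → Set
IsSchur π = All (λ p → 1 ℕ.≤ p) π × Linked SchurGap π

isSchur? : (π : List ℕ) → Dec (IsSchur π)
isSchur? π = all? (λ p → 1 ℕ.≤? p) π ×-dec linked? schurGap? π

mval : List ℕ → ℕ
mval π = length π + length (filter (2 ∣?_) π)

InD : ℤ → ℤ → ℤ → List ℕ → Set
InD M m n π = IsSchur π × All (λ p → + p ℤ.≤ M) π × (+ sum π ≡ n) × (+ mval π ≡ m)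

inD? : (M m n : ℤ) (π : List ℕ) → Dec (InD M m n π)
inD? M m n π = isSchur? π ×-dec (all? (λ p → + p ℤ.≤? M) π ×-dec ((+ sum π ℤ.≟ n) ×-dec (+ mval π ℤ.≟ m)))

𝒟 : ℤ → ℤ → ℤ → Set
𝒟 M m n = Σ (List ℕ) (λ π → True (inD? M m n π))

sublists : {A : Set} → List A → List (List A)
sublists []       = [] ∷ []
sublists (x ∷ xs) = map (x ∷_) (sublists xs) ++ sublists xs

-- D_M(m,n) = |𝒟_M(m,n)|, computed by enumerating all strictly decreasing
-- lists of parts from {|n|,…,1} (every element of 𝒟_M(m,n) is such a list,
-- occurring exactly once).
D : ℤ → ℤ → ℤ → ℕ
D M m n = length (filter (inD? M m n) (sublists (map suc (downFrom ℤ.∣ n ∣))))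

-- Formal power series in x, q with ℕ coefficients: F m n = coeff of x^m q^n.
PS : Set
PS = ℕ → ℕ → ℕ

_≐_ : PS → PS → Set
F ≐ G = ∀ m n → F m n ≡ G m n

d : ℤ → PS
d M m n = D M (+ m) (+ n)

substXQ² : PS → PS
substXQ² F m n = if ⌊ 2 * m ℕ.≤? n ⌋ then F m (n ∸ 2 * m) else 0

mulXQ : PS → PS
mulXQ F zero    _       = 0
mulXQ F (suc m) zero    = 0
mulXQ F (suc m) (suc n) = F m n

mul1+xq+x²q² : PS → PS
mul1+xq+x²q² F m n = F m n + mulXQ F m n + mulXQ (mulXQ F) m n

-- Read a Schur partition with parts ≤ 2N from its largest part down.  An even part x followed
-- by an odd part y with x − y = 3, or with x − y = 5 and x ≡ 1 (mod 3), becomes the odd–even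
-- pair (x − 3, y − 3); every other part x becomes x − 4 if it is even and x − 2 if it is odd.
-- Each part thus drops by twice its contribution to m, so m is kept and n drops by 2m; the gap
-- conditions survive, and since 2N is even all parts end up ≤ 2N − 3.  Only at the bottom does
-- this fail to give a partition (a last part 1, 2 or 4, or a last pair (4, 1)); these cases are
-- handled by a tag c ∈ {0, 1, 2}, and the image lies in 𝒟_{2N−3}(m − c, n − 2m + c).  The inverse
-- raises parts the same way and turns the odd–even pairs back into even–odd ones.  Every local
-- fact used concerns two consecutive parts a + z > b + z, depends on z only through its parity
-- and residue mod 3, and stops depending on a once a − b is large, so it is decided by a finite
-- check.  Counting both sides gives the recurrence for D, and comparing coefficients gives the
-- identity for d_{2N}.

module Submission where

open import Defs
open import Level using (0ℓ)
open import Data.Nat using (ℕ; zero; suc; _+_; _*_; _∸_; _≤_; _<_; _>_; _≡ᵇ_; _≤ᵇ_; _≤?_; _<?_; z≤n; s≤s)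
open import Data.Nat.Properties as ℕP using ()
open import Data.Nat.Divisibility using (_∣_; _∣?_; divides; ∣m+n∣m⇒∣n; ∣m∣n⇒∣m+n; ∣-refl)
open import Data.Nat.ListAction using (sum)
import Data.Nat.Tactic.RingSolver as ℕ-Solver
open import Data.Integer as ℤ using (ℤ; +_; _-_; -_; -[1+_]; +≤+)
open import Data.Integer.Properties as ℤP using ()
import Data.Integer.Tactic.RingSolver as ℤ-Solver
open import Data.Bool using (Bool; true; false; not; _∧_; _∨_; T; if_then_else_)
open import Data.Bool.Properties using (T-irrelevant; not-involutive; ∧-conicalˡ; ∧-conicalʳ; ∧-zeroʳ)
open import Data.Fin using (Fin)
open import Data.Fin.Properties using (+↔⊎)
open import Data.Fin.Permutation using (↔⇒≡)
open import Data.List as List using (List; []; _∷_; length; filter; map; downFrom; lookup)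
open import Data.List.Properties using (filter-accept; filter-reject; filter-none)
open import Data.List.Relation.Unary.All as All using (All; []; _∷_)
open import Data.List.Relation.Unary.Any as Any using (here)
open import Data.List.Relation.Unary.Any.Properties using (lookup-index)
open import Data.List.Relation.Unary.Linked as Linked using (Linked; []; [-]; _∷_; _∷′_)
open import Data.List.Relation.Unary.Linked.Properties using (Linked⇒All)
open import Data.List.Relation.Unary.Unique.Propositional using (Unique; []; _∷_)
import Data.List.Relation.Unary.Unique.Propositional.Properties as Unique
open import Data.List.Membership.Propositional using (_∈_)
open import Data.List.Membership.Propositional.Properties
  using (∈-filter⁺; ∈-filter⁻; ∈-map⁺; ∈-map⁻; ∈-++⁺ˡ; ∈-++⁺ʳ; ∈-++⁻; ∈-lookup)
open import Data.List.Membership.Propositional.Properties.WithK using (unique⇒irrelevant)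
open import Data.Maybe using (just)
open import Data.Maybe.Relation.Binary.Connected using (Connected; just; just-nothing)
open import Data.Product using (Σ; _×_; _,_; proj₁; proj₂; map₁)
open import Data.Sum using (_⊎_; inj₁; inj₂)
open import Data.Sum.Function.Propositional using (_⊎-↔_)
open import Data.Unit using (⊤; tt)
open import Function using (_∘_; _∘′_)
open import Function.Bundles using (_↔_; _⤖_; _⇔_; mk↔ₛ′; mk⇔; module Equivalence)
open import Function.Construct.Composition using (_↔-∘_)
open import Function.Construct.Identity using (↔-id)
open import Function.Construct.Symmetry using (↔-sym)
open import Function.Properties.Inverse using (↔⇒⤖)
open import Relation.Binary.PropositionalEquality
open import Relation.Nullary using (¬_; yes; no; contradiction)
open import Relation.Nullary.Decidable using (True; toWitness; fromWitness)
open import Relation.Unary using (Pred; Decidable)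

-- Counting the elements of a decidable subset

index-∈-lookup : ∀ {A : Set} (xs : List A) i → Any.index (∈-lookup {xs = xs} i) ≡ i
index-∈-lookup (_ ∷ xs) Fin.zero    = refl
index-∈-lookup (_ ∷ xs) (Fin.suc i) = cong Fin.suc (index-∈-lookup xs i)

Σ-True-≡ : ∀ {A : Set} {P : Pred A 0ℓ} {P? : Decidable P} {x y : A} → x ≡ y →
           (s : True (P? x)) (t : True (P? y)) → _≡_ {A = Σ A (True ∘ P?)} (x , s) (y , t)
Σ-True-≡ refl s t = cong (_ ,_) (T-irrelevant s t)

module _ {A : Set} {P : Pred A 0ℓ} (P? : Decidable P) {zs : List A}
         (unique : Unique zs) (complete : ∀ {x} → P x → x ∈ zs) where

  Σ-True↔Fin-filter : Σ A (True ∘ P?) ↔ Fin (length (filter P? zs))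
  Σ-True↔Fin-filter = mk↔ₛ′ to from to∘from from∘to
    where
    member : ∀ {x} → P x → x ∈ filter P? zs
    member p = ∈-filter⁺ P? (complete p) p

    to : Σ A (True ∘ P?) → Fin (length (filter P? zs))
    to (x , t) = Any.index (member (toWitness t))

    from : Fin (length (filter P? zs)) → Σ A (True ∘ P?)
    from i = lookup (filter P? zs) i , fromWitness (proj₂ (∈-filter⁻ P? {xs = zs} (∈-lookup i)))

    to∘from : ∀ i → to (from i) ≡ i
    to∘from i = trans (cong Any.index (unique⇒irrelevant (Unique.filter⁺ P? unique) _ (∈-lookup i)))
                      (index-∈-lookup (filter P? zs) i)

    from∘to : ∀ p → from (to p) ≡ p
    from∘to (x , t) = Σ-True-≡ (sym (lookup-index (member (toWitness t)))) _ t

↔⇒card≡ : ∀ {A B : Set} {a b} → A ↔ B → A ↔ Fin a → B ↔ Fin b → a ≡ b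
↔⇒card≡ A↔B A↔a B↔b = ↔⇒≡ (B↔b ↔-∘ (A↔B ↔-∘ ↔-sym A↔a))

Fin-+³↔⊎ : ∀ a b c → Fin (a + b + c) ↔ (Fin a ⊎ (Fin b ⊎ Fin c))
Fin-+³↔⊎ a b c rewrite ℕP.+-assoc a b c = (↔-id (Fin a) ⊎-↔ +↔⊎) ↔-∘ +↔⊎

downFrom⁺ : ℕ → List ℕ
downFrom⁺ k = map suc (downFrom k)

sublists-downFrom⁺-bounded : ∀ k {ρ} → ρ ∈ sublists (downFrom⁺ k) → All (_≤ k) ρ
sublists-downFrom⁺-bounded zero (here refl) = []
sublists-downFrom⁺-bounded (suc k) ρ∈ with ∈-++⁻ (map (suc k ∷_) (sublists (downFrom⁺ k))) ρ∈
... | inj₂ ρ∈′ = All.map ℕP.m≤n⇒m≤1+n (sublists-downFrom⁺-bounded k ρ∈′)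
... | inj₁ ρ∈′ with ∈-map⁻ (suc k ∷_) ρ∈′
...   | _ , σ∈ , refl = ℕP.≤-refl ∷ All.map ℕP.m≤n⇒m≤1+n (sublists-downFrom⁺-bounded k σ∈)

sublists-downFrom⁺-unique : ∀ k → Unique (sublists (downFrom⁺ k))
sublists-downFrom⁺-unique zero    = [] ∷ []
sublists-downFrom⁺-unique (suc k) =
  Unique.++⁺ (Unique.map⁺ ∷-injectiveʳ (sublists-downFrom⁺-unique k)) (sublists-downFrom⁺-unique k) disjoint
  where
  ∷-injectiveʳ : ∀ {σ ρ : List ℕ} → suc k ∷ σ ≡ suc k ∷ ρ → σ ≡ ρ
  ∷-injectiveʳ refl = refl
  disjoint : ∀ {ρ} → ¬ (ρ ∈ map (suc k ∷_) (sublists (downFrom⁺ k)) × ρ ∈ sublists (downFrom⁺ k))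
  disjoint (ρ∈₁ , ρ∈₂) with ∈-map⁻ (suc k ∷_) ρ∈₁
  ... | _ , _ , refl with sublists-downFrom⁺-bounded k ρ∈₂
  ...   | 1+k≤k ∷ _ = ℕP.<-irrefl refl 1+k≤k

head>tail : ∀ {p π} → Linked _>_ (p ∷ π) → All (_< p) π
head>tail [-]       = []
head>tail (p>q ∷ l) = Linked⇒All (λ a>b b>c → ℕP.<-trans b>c a>b) p>q l

∈-sublists-downFrom⁺ : ∀ k {π} → Linked _>_ π → All (1 ≤_) π → All (_≤ k) π → π ∈ sublists (downFrom⁺ k)
∈-sublists-downFrom⁺ zero    {[]}    _ _ _ = here refl
∈-sublists-downFrom⁺ zero    {p ∷ π} _ (1≤p ∷ _) (p≤0 ∷ _) with () ← ℕP.≤-trans 1≤p p≤0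
∈-sublists-downFrom⁺ (suc k) {[]}    _ _ _ = ∈-++⁺ʳ _ (∈-sublists-downFrom⁺ k [] [] [])
∈-sublists-downFrom⁺ (suc k) {p ∷ π} dec (1≤p ∷ pos) (p≤1+k ∷ bounded) with p ℕP.≟ suc k
... | yes refl = ∈-++⁺ˡ (∈-map⁺ (suc k ∷_)
                   (∈-sublists-downFrom⁺ k (Linked.tail dec) pos (All.map ℕP.≤-pred (head>tail dec))))
... | no p≢1+k = ∈-++⁺ʳ _ (∈-sublists-downFrom⁺ k dec (1≤p ∷ pos)
                   (p≤k ∷ All.map (λ q<p → ℕP.≤-trans (ℕP.<⇒≤ q<p) p≤k) (head>tail dec)))
  where p≤k = ℕP.≤-pred (ℕP.≤∧≢⇒< p≤1+k p≢1+k)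

SchurGap⇒> : ∀ {a b} → SchurGap a b → a > b
SchurGap⇒> (b+3≤a , _) = ℕP.<-≤-trans (ℕP.m<m+n _ (s≤s z≤n)) b+3≤a

parts≤sum : ∀ π → All (_≤ sum π) π
parts≤sum []      = []
parts≤sum (p ∷ π) =
  ℕP.m≤m+n p (sum π) ∷ All.map (λ q≤ → ℕP.≤-trans q≤ (ℕP.m≤n+m (sum π) p)) (parts≤sum π)

InD⇒∈-sublists : ∀ {M m n π} → InD M m n π → π ∈ sublists (downFrom⁺ ℤ.∣ n ∣)
InD⇒∈-sublists {π = π} ((pos , gaps) , _ , refl , _) =
  ∈-sublists-downFrom⁺ (sum π) (Linked.map SchurGap⇒> gaps) pos (parts≤sum π)

𝒟↔Fin-D : ∀ M m n → 𝒟 M m n ↔ Fin (D M m n)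
𝒟↔Fin-D M m n = Σ-True↔Fin-filter (inD? M m n) (sublists-downFrom⁺-unique ℤ.∣ n ∣) InD⇒∈-sublists

x+y-y≡x : ∀ (x y : ℤ) → x ℤ.+ y - y ≡ x
x+y-y≡x = ℤ-Solver.solve-∀

x-y+y≡x : ∀ (x y : ℤ) → x - y ℤ.+ y ≡ x
x-y+y≡x = ℤ-Solver.solve-∀

+≡-⇔ : ∀ a b c → (a + b ≡ c) ⇔ (+ a ≡ + c - + b)
+≡-⇔ a b c = mk⇔
  (λ a+b≡c → trans (sym (x+y-y≡x (+ a) (+ b))) (cong (λ k → + k - + b) a+b≡c))
  (λ a≡c-b → ℤP.+-injective (trans (cong (ℤ._+ + b) a≡c-b) (x-y+y≡x (+ c) (+ b))))

+≡+-+⇔ : ∀ a b c d → (a + b ≡ c + d) ⇔ (+ a ≡ + c - + b ℤ.+ + d)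
+≡+-+⇔ a b c d = mk⇔
  (λ eq → trans (Equivalence.to (+≡-⇔ a b (c + d)) eq) (rearrange (+ c) (+ d) (+ b)))
  (λ eq → Equivalence.from (+≡-⇔ a b (c + d)) (trans eq (sym (rearrange (+ c) (+ d) (+ b)))))
  where
  rearrange : ∀ c d b → c ℤ.+ d - b ≡ c - b ℤ.+ d
  rearrange = ℤ-Solver.solve-∀

+≤-3⇔ : ∀ p M → (p + 3 ≤ M) ⇔ (+ p ℤ.≤ + M - + 3)
+≤-3⇔ p M = mk⇔
  (λ p+3≤M → subst (ℤ._≤ + M - + 3) (x+y-y≡x (+ p) (+ 3)) (ℤP.+-monoˡ-≤ (ℤ.- + 3) (+≤+ p+3≤M)))
  (λ p≤M-3 → ℤP.drop‿+≤+ (subst (+ (p + 3) ℤ.≤_) (x-y+y≡x (+ M) (+ 3)) (ℤP.+-monoˡ-≤ (+ 3) p≤M-3)))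

∸-suc-< : ∀ {n k} → n < k → k ∸ n ≡ suc (k ∸ suc n)
∸-suc-< {zero}  {suc k} _         = refl
∸-suc-< {suc n} {suc k} (s≤s n<k) = ∸-suc-< n<k

-<⇒-[1+] : ∀ {n k} → n < k → + n - + k ≡ -[1+ (k ∸ suc n) ]
-<⇒-[1+] {n} {k} n<k = begin
  + n - + k      ≡⟨ ℤP.m-n≡m⊖n n k ⟩
  n ℤ.⊖ k        ≡⟨ ℤP.⊖-< n<k ⟩
  - + (k ∸ n)    ≡⟨ cong (-_ ∘′ +_) (∸-suc-< n<k) ⟩
  -[1+ (k ∸ suc n) ] ∎
  where open ≡-Reasoning

-≥⇒+∸ : ∀ {n k} → k ≤ n → + n - + k ≡ + (n ∸ k)
-≥⇒+∸ {n} {k} k≤n = trans (ℤP.m-n≡m⊖n n k) (ℤP.⊖-≥ k≤n)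

D-negative-index₁ : ∀ M k n → D M -[1+ k ] n ≡ 0
D-negative-index₁ M k n =
  cong length (filter-none (inD? M -[1+ k ] n) (All.universal m-mismatch (sublists (downFrom⁺ ℤ.∣ n ∣))))
  where
  m-mismatch : ∀ π → ¬ InD M -[1+ k ] n π
  m-mismatch _ (_ , _ , _ , ())

D-negative-index₂ : ∀ M m k → D M m -[1+ k ] ≡ 0
D-negative-index₂ M m k =
  cong length (filter-none (inD? M m -[1+ k ]) (All.universal n-mismatch (sublists (downFrom⁺ (suc k)))))
  where
  n-mismatch : ∀ π → ¬ InD M m -[1+ k ] π
  n-mismatch _ (_ , _ , () , _)

substXQ²-d : ∀ M m n → substXQ² (d M) m n ≡ D M (+ m) (+ n - + (2 * m))
substXQ²-d M m n with 2 * m ≤? n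
... | yes 2m≤n = cong (D M (+ m)) (sym (-≥⇒+∸ 2m≤n))
... | no 2m≰n  =
  sym (trans (cong (D M (+ m)) (-<⇒-[1+] (ℕP.≰⇒> 2m≰n))) (D-negative-index₂ M (+ m) (2 * m ∸ suc n)))

-- F is (xq)^k · d_M(xq²), read coefficientwise.
ShiftedByXQ : ℤ → ℕ → PS → Set
ShiftedByXQ M k F = ∀ m n → F m n ≡ D M (+ m - + k) (+ n - + (2 * m) ℤ.+ + k)

substXQ²-d-ShiftedByXQ⁰ : ∀ M → ShiftedByXQ M 0 (substXQ² (d M))
substXQ²-d-ShiftedByXQ⁰ M m n =
  trans (substXQ²-d M m n) (sym (cong₂ (D M) (ℤP.+-identityʳ (+ m)) (ℤP.+-identityʳ (+ n - + (2 * m)))))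

mulXQ-ShiftedByXQ : ∀ {M k F} → ShiftedByXQ M k F → ShiftedByXQ M (suc k) (mulXQ F)
mulXQ-ShiftedByXQ {M} {k} F≡ zero    n = sym (D-negative-index₁ M k (+ n - + 0 ℤ.+ + suc k))
mulXQ-ShiftedByXQ {M} {k} F≡ (suc m) zero with m <? k
... | yes m<k = sym (trans (cong (λ i → D M i n′) (-<⇒-[1+] (s≤s m<k))) (D-negative-index₁ M (k ∸ suc m) n′))
  where n′ = + 0 - + (2 * suc m) ℤ.+ + suc k
... | no m≮k  = sym (begin
  D M m′ (+ 0 - + (2 * suc m) ℤ.+ + suc k) ≡⟨ cong (D M m′) (0-a+b≡b-a (+ (2 * suc m)) (+ suc k)) ⟩
  D M m′ (+ suc k - + (2 * suc m))          ≡⟨ cong (D M m′) (-<⇒-[1+] 1+k<2+2m) ⟩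
  D M m′ -[1+ t ]                           ≡⟨ D-negative-index₂ M m′ t ⟩
  0                                         ∎)
  where
  open ≡-Reasoning
  m′ = + suc m - + suc k
  t = 2 * suc m ∸ suc (suc k)
  0-a+b≡b-a : ∀ a b → + 0 - a ℤ.+ b ≡ b - a
  0-a+b≡b-a = ℤ-Solver.solve-∀
  1+k<2+2m : suc k < 2 * suc m
  1+k<2+2m = ℕP.≤-<-trans (s≤s (ℕP.≮⇒≥ m≮k)) (ℕP.m<m+n (suc m) (s≤s z≤n))
mulXQ-ShiftedByXQ {M} {k} F≡ (suc m) (suc n) =
  trans (F≡ m n) (cong₂ (D M) (first (+ m) (+ k)) (begin
    + n - + (2 * m) ℤ.+ + k                ≡⟨ cong (λ i → + n - i ℤ.+ + k) (ℤP.pos-* 2 m) ⟩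
    + n - + 2 ℤ.* + m ℤ.+ + k              ≡⟨ second (+ n) (+ m) (+ k) ⟩
    + suc n - + 2 ℤ.* + suc m ℤ.+ + suc k  ≡⟨ cong (λ i → + suc n - i ℤ.+ + suc k) (ℤP.pos-* 2 (suc m)) ⟨
    + suc n - + (2 * suc m) ℤ.+ + suc k    ∎))
  where
  open ≡-Reasoning
  first : ∀ m k → m - k ≡ (+ 1 ℤ.+ m) - (+ 1 ℤ.+ k)
  first = ℤ-Solver.solve-∀
  second : ∀ n m k → n - + 2 ℤ.* m ℤ.+ k ≡ (+ 1 ℤ.+ n) - + 2 ℤ.* (+ 1 ℤ.+ m) ℤ.+ (+ 1 ℤ.+ k)
  second = ℤ-Solver.solve-∀

d-≐-of-D-recurrence : ∀ M′ M →
  (∀ m n → D M′ (+ m) (+ n) ≡ D M (+ m) (+ n - + (2 * m))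
                              + D M (+ m - + 1) (+ n - + (2 * m) ℤ.+ + 1)
                              + D M (+ m - + 2) (+ n - + (2 * m) ℤ.+ + 2)) →
  d M′ ≐ mul1+xq+x²q² (substXQ² (d M))
d-≐-of-D-recurrence M′ M recurrence m n = begin
  D M′ (+ m) (+ n)  ≡⟨ recurrence m n ⟩
  _                 ≡⟨ cong₂ _+_ (cong₂ _+_ (substXQ²-d M m n) (xq¹ m n)) (xq² m n) ⟨
  mul1+xq+x²q² (substXQ² (d M)) m n ∎
  where
  open ≡-Reasoning
  xq¹ = mulXQ-ShiftedByXQ (substXQ²-d-ShiftedByXQ⁰ M)
  xq² = mulXQ-ShiftedByXQ xq¹

data Mod3 : Set where
  r0 r1 r2 : Mod3

next₃ : Mod3 → Mod3
next₃ r0 = r1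
next₃ r1 = r2
next₃ r2 = r0

mod3 : ℕ → Mod3
mod3 zero    = r0
mod3 (suc n) = next₃ (mod3 n)

isR0 : Mod3 → Bool
isR0 r0 = true
isR0 _  = false

isR1 : Mod3 → Bool
isR1 r1 = true
isR1 _  = false

isEven : ℕ → Bool
isEven zero    = true
isEven (suc n) = not (isEven n)

evenAfter : ℕ → Bool → Bool
evenAfter zero    e = e
evenAfter (suc k) e = not (evenAfter k e)

next₃^ : ℕ → Mod3 → Mod3
next₃^ zero    r = r
next₃^ (suc k) r = next₃ (next₃^ k r)

isEven-+ : ∀ k z → isEven (k + z) ≡ evenAfter k (isEven z)
isEven-+ zero    z = refl
isEven-+ (suc k) z = cong not (isEven-+ k z)

isEven-3+ : ∀ a → isEven (3 + a) ≡ not (isEven a)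
isEven-3+ a = not-involutive (not (isEven a))

mod3-+ : ∀ k z → mod3 (k + z) ≡ next₃^ k (mod3 z)
mod3-+ zero    z = refl
mod3-+ (suc k) z = cong next₃ (mod3-+ k z)

mod3≡r0⇒3∣ : ∀ n → mod3 n ≡ r0 → 3 ∣ n
mod3≡r0⇒3∣ zero                _ = divides 0 refl
mod3≡r0⇒3∣ (suc (suc (suc n))) e with mod3 n in eq
... | r0 with divides q n≡q*3 ← mod3≡r0⇒3∣ n eq = divides (suc q) (cong (_+_ 3) n≡q*3)

3∣⇒mod3≡r0 : ∀ n → 3 ∣ n → mod3 n ≡ r0
3∣⇒mod3≡r0 zero                _ = refl
3∣⇒mod3≡r0 (suc zero)          (divides (suc q) ())
3∣⇒mod3≡r0 (suc (suc zero))    (divides (suc q) ())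
3∣⇒mod3≡r0 (suc (suc (suc n))) 3∣3+n
  rewrite 3∣⇒mod3≡r0 n (∣m+n∣m⇒∣n {m = 3} 3∣3+n ∣-refl) = refl

isEven⇒2∣ : ∀ n → isEven n ≡ true → 2 ∣ n
isEven⇒2∣ zero          _ = divides 0 refl
isEven⇒2∣ (suc (suc n)) e with divides q n≡q*2 ← isEven⇒2∣ n (trans (sym (not-involutive _)) e) =
  divides (suc q) (cong (_+_ 2) n≡q*2)

2∣⇒isEven : ∀ n → 2 ∣ n → isEven n ≡ true
2∣⇒isEven zero          _ = refl
2∣⇒isEven (suc zero)    (divides (suc q) ())
2∣⇒isEven (suc (suc n)) 2∣2+n =
  trans (not-involutive _) (2∣⇒isEven n (∣m+n∣m⇒∣n {m = 2} 2∣2+n ∣-refl))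

-- Relations between consecutive parts, decided on a finite window

≡ᵇ-true⇒≡ : ∀ {m n} → (m ≡ᵇ n) ≡ true → m ≡ n
≡ᵇ-true⇒≡ {m} {n} e = ℕP.≡ᵇ⇒≡ m n (subst T (sym e) tt)

≡⇒≡ᵇ-true : ∀ {m n} → m ≡ n → (m ≡ᵇ n) ≡ true
≡⇒≡ᵇ-true {m} {n} e with m ≡ᵇ n | ℕP.≡⇒≡ᵇ m n e
... | true | _ = refl

≤ᵇ-true⇒≤ : ∀ {m n} → (m ≤ᵇ n) ≡ true → m ≤ n
≤ᵇ-true⇒≤ {m} {n} e = ℕP.≤ᵇ⇒≤ m n (subst T (sym e) tt)

≤⇒≤ᵇ-true : ∀ {m n} → m ≤ n → (m ≤ᵇ n) ≡ true
≤⇒≤ᵇ-true {m} {n} le with m ≤ᵇ n | ℕP.≤⇒≤ᵇ le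
... | true | _ = refl

not-true⇒false : ∀ {b} → not b ≡ true → b ≡ false
not-true⇒false {false} _ = refl

false⇒not-true : ∀ {b} → b ≡ false → not b ≡ true
false⇒not-true refl = refl

not-false⇒true : ∀ {b} → not b ≡ false → b ≡ true
not-false⇒true {true} _ = refl

∧-true : ∀ {a b} → a ≡ true → b ≡ true → a ∧ b ≡ true
∧-true refl refl = refl

∧-true⁻ : ∀ a {b} → a ∧ b ≡ true → a ≡ true × b ≡ true
∧-true⁻ true e = refl , e

isR0-true⇒≡r0 : ∀ {r} → isR0 r ≡ true → r ≡ r0
isR0-true⇒≡r0 {r0} _ = refl

-- The Schur condition on parts a + z and b + z, in terms of a, b and r = mod3 z.
schurGapᵇ : ℕ → ℕ → Mod3 → Bool
schurGapᵇ a b r = (b + 3 ≤ᵇ a) ∧ not ((a ≡ᵇ b + 3) ∧ isR0 (next₃^ b r))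

+-shift-3 : ∀ b z → b + z + 3 ≡ b + 3 + z
+-shift-3 b z = trans (ℕP.+-assoc b z 3) (trans (cong (_+_ b) (ℕP.+-comm z 3)) (sym (ℕP.+-assoc b 3 z)))

schurGapᵇ-sound : ∀ a b z → schurGapᵇ a b (mod3 z) ≡ true → SchurGap (a + z) (b + z)
schurGapᵇ-sound a b z ok = gap , not-multiples
  where
  gap : b + z + 3 ≤ a + z
  gap = subst (_≤ a + z) (sym (+-shift-3 b z)) (ℕP.+-monoˡ-≤ z (≤ᵇ-true⇒≤ (∧-conicalˡ _ _ ok)))
  not-multiples : ¬ ((a + z ≡ b + z + 3) × (3 ∣ a + z) × (3 ∣ b + z))
  not-multiples (a+z≡ , _ , 3∣b+z) =
    contradiction (trans (sym (∧-true (≡⇒≡ᵇ-true a≡b+3) b+z≡0)) (not-true⇒false (∧-conicalʳ _ _ ok))) λ ()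
    where
    a≡b+3 : a ≡ b + 3
    a≡b+3 = ℕP.+-cancelʳ-≡ z a (b + 3) (trans a+z≡ (+-shift-3 b z))
    b+z≡0 : isR0 (next₃^ b (mod3 z)) ≡ true
    b+z≡0 = cong isR0 (trans (sym (mod3-+ b z)) (3∣⇒mod3≡r0 _ 3∣b+z))

schurGapᵇ-complete : ∀ a b z → SchurGap (a + z) (b + z) → schurGapᵇ a b (mod3 z) ≡ true
schurGapᵇ-complete a b z (gap , not-multiples) = ∧-true (≤⇒≤ᵇ-true b+3≤a) (false⇒not-true exceptional)
  where
  b+3≤a : b + 3 ≤ a
  b+3≤a = ℕP.+-cancelʳ-≤ z (b + 3) a (subst (_≤ a + z) (+-shift-3 b z) gap)
  exceptional : ((a ≡ᵇ b + 3) ∧ isR0 (next₃^ b (mod3 z))) ≡ false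
  exceptional with a ≡ᵇ b + 3 in a≡ | isR0 (next₃^ b (mod3 z)) in b+z≡0
  ... | false | _     = refl
  ... | true  | false = refl
  ... | true  | true  = contradiction (a+z≡ , subst (3 ∣_) (sym a+z≡′) 3∣3+b+z , 3∣b+z) not-multiples
    where
    a+z≡ : a + z ≡ b + z + 3
    a+z≡ = trans (cong (_+ z) (≡ᵇ-true⇒≡ a≡)) (sym (+-shift-3 b z))
    a+z≡′ : a + z ≡ 3 + (b + z)
    a+z≡′ = trans a+z≡ (ℕP.+-comm (b + z) 3)
    3∣b+z : 3 ∣ b + z
    3∣b+z = mod3≡r0⇒3∣ (b + z) (trans (mod3-+ b z) (isR0-true⇒≡r0 b+z≡0))
    3∣3+b+z : 3 ∣ 3 + (b + z)
    3∣3+b+z = ∣m∣n⇒∣m+n ∣-refl 3∣b+z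

closeGapᵇ : ℕ → Mod3 → Bool
closeGapᵇ d r = (d ≡ᵇ 3) ∨ ((d ≡ᵇ 5) ∧ isR1 r)

evenOddPairᵇ : ℕ → ℕ → Bool
evenOddPairᵇ x y = isEven x ∧ (not (isEven y) ∧ closeGapᵇ (x ∸ y) (mod3 x))

oddEvenPairᵇ : ℕ → ℕ → Bool
oddEvenPairᵇ s t = not (isEven s) ∧ (isEven t ∧ closeGapᵇ (s ∸ t) (mod3 s))

lower : ℕ → ℕ
lower x = if isEven x then x ∸ 4 else x ∸ 2

raise : ℕ → ℕ
raise s = if isEven s then 4 + s else 2 + s

-- The pair tests and the shifts applied to a + z (and b + z), in terms of a, b, e = isEven z
-- and r = mod3 z.
evenOddPairRel : ℕ → ℕ → Bool → Mod3 → Bool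
evenOddPairRel a b e r = evenAfter a e ∧ (not (evenAfter b e) ∧ closeGapᵇ (a ∸ b) (next₃^ a r))

oddEvenPairRel : ℕ → ℕ → Bool → Mod3 → Bool
oddEvenPairRel a b e r = not (evenAfter a e) ∧ (evenAfter b e ∧ closeGapᵇ (a ∸ b) (next₃^ a r))

lowerRel : ℕ → Bool → ℕ
lowerRel a e = if evenAfter a e then a ∸ 4 else a ∸ 2

raiseRel : ℕ → Bool → ℕ
raiseRel a e = if evenAfter a e then 4 + a else 2 + a

[a+z]∸[b+z]≡a∸b : ∀ a b z → (a + z) ∸ (b + z) ≡ a ∸ b
[a+z]∸[b+z]≡a∸b a b z = trans (cong₂ _∸_ (ℕP.+-comm a z) (ℕP.+-comm b z)) (ℕP.[m+n]∸[m+o]≡n∸o z a b)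

evenOddPair-+ : ∀ a b z → evenOddPairᵇ (a + z) (b + z) ≡ evenOddPairRel a b (isEven z) (mod3 z)
evenOddPair-+ a b z rewrite isEven-+ a z | isEven-+ b z | mod3-+ a z | [a+z]∸[b+z]≡a∸b a b z = refl

oddEvenPair-+ : ∀ a b z → oddEvenPairᵇ (a + z) (b + z) ≡ oddEvenPairRel a b (isEven z) (mod3 z)
oddEvenPair-+ a b z rewrite isEven-+ a z | isEven-+ b z | mod3-+ a z | [a+z]∸[b+z]≡a∸b a b z = refl

lower-+ : ∀ a z → 4 ≤ a → lower (a + z) ≡ lowerRel a (isEven z) + z
lower-+ a z 4≤a rewrite isEven-+ a z with evenAfter a (isEven z)
... | true  = ℕP.+-∸-comm z 4≤a
... | false = ℕP.+-∸-comm z (ℕP.≤-trans (ℕP.n≤1+n 2) (ℕP.≤-trans (ℕP.n≤1+n 3) 4≤a))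

raise-+ : ∀ a z → raise (a + z) ≡ raiseRel a (isEven z) + z
raise-+ a z rewrite isEven-+ a z with evenAfter a (isEven z)
... | true  = refl
... | false = refl

forAllMod3 : (Mod3 → Bool) → Bool
forAllMod3 g = g r0 ∧ (g r1 ∧ g r2)

forAllMod3-sound : ∀ g → forAllMod3 g ≡ true → ∀ r → g r ≡ true
forAllMod3-sound g h r0 = ∧-conicalˡ (g r0) _ h
forAllMod3-sound g h r1 = ∧-conicalˡ (g r1) _ (∧-conicalʳ (g r0) _ h)
forAllMod3-sound g h r2 = ∧-conicalʳ (g r1) _ (∧-conicalʳ (g r0) _ h)

forAllResidues : (Bool → Mod3 → Bool) → Bool
forAllResidues f = forAllMod3 (f true) ∧ forAllMod3 (f false)

forAllResidues-sound : ∀ f → forAllResidues f ≡ true → ∀ e r → f e r ≡ true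
forAllResidues-sound f h true  = forAllMod3-sound (f true) (∧-conicalˡ (forAllMod3 (f true)) _ h)
forAllResidues-sound f h false = forAllMod3-sound (f false) (∧-conicalʳ (forAllMod3 (f true)) _ h)

RelPred : Set
RelPred = ℕ → Bool → Mod3 → Bool

forAllBelow : ℕ → RelPred → Bool
forAllBelow zero    f = true
forAllBelow (suc n) f = forAllResidues (f n) ∧ forAllBelow n f

forAllBelow-sound : ∀ n f → forAllBelow n f ≡ true → ∀ a → a < n → ∀ e r → f a e r ≡ true
forAllBelow-sound (suc n) f h a a<1+n with a ℕP.≟ n
... | yes refl = forAllResidues-sound (f a) (∧-conicalˡ (forAllResidues (f a)) _ h)
... | no a≢n   =
  forAllBelow-sound n f (∧-conicalʳ (forAllResidues (f n)) _ h) a (ℕP.≤∧≢⇒< (ℕP.≤-pred a<1+n) a≢n)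

-- Once a − b ≥ 6 the relations above are constant (a Schur gap, no pair), so an implication
-- between them is settled by evaluating all cases a < 16 and arguing separately for large a.
_⟶ᵇ_ : RelPred → RelPred → RelPred
(H ⟶ᵇ C) a e r = not (H a e r) ∨ C a e r

by-window : ∀ (H C : RelPred) → forAllBelow 16 (H ⟶ᵇ C) ≡ true →
  (∀ a e r → 16 ≤ a → H a e r ≡ true → C a e r ≡ true) →
  ∀ a e r → H a e r ≡ true → C a e r ≡ true
by-window H C small large a e r h with a <? 16
... | no a≮16 = large a e r (ℕP.≮⇒≥ a≮16) h
... | yes a<16 with H a e r | forAllBelow-sound 16 (H ⟶ᵇ C) small a a<16 e r
...   | true | c = c

closeGapᵇ-large : ∀ {d} r → 6 ≤ d → closeGapᵇ d r ≡ false
closeGapᵇ-large r (s≤s (s≤s (s≤s (s≤s (s≤s (s≤s _)))))) = refl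

b+6≤a⇒6≤a∸b : ∀ {a b} → b + 6 ≤ a → 6 ≤ a ∸ b
b+6≤a⇒6≤a∸b {a} {b} le = subst (_≤ a ∸ b) (ℕP.m+n∸m≡n b 6) (ℕP.∸-monoˡ-≤ b le)

evenOddPairRel-large : ∀ {a b} e r → b + 6 ≤ a → evenOddPairRel a b e r ≡ false
evenOddPairRel-large {a} {b} e r le
  rewrite closeGapᵇ-large (next₃^ a r) (b+6≤a⇒6≤a∸b le) | ∧-zeroʳ (not (evenAfter b e)) =
  ∧-zeroʳ (evenAfter a e)

oddEvenPairRel-large : ∀ {a b} e r → b + 6 ≤ a → oddEvenPairRel a b e r ≡ false
oddEvenPairRel-large {a} {b} e r le
  rewrite closeGapᵇ-large (next₃^ a r) (b+6≤a⇒6≤a∸b le) | ∧-zeroʳ (evenAfter b e) =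
  ∧-zeroʳ (not (evenAfter a e))

schurGapᵇ-large : ∀ {a b} r → b + 4 ≤ a → schurGapᵇ a b r ≡ true
schurGapᵇ-large {a} {b} r le =
  ∧-true (≤⇒≤ᵇ-true (ℕP.≤-trans (ℕP.+-monoʳ-≤ b (ℕP.n≤1+n 3)) le)) (false⇒not-true exceptional)
  where
  exceptional : ((a ≡ᵇ b + 3) ∧ isR0 (next₃^ b r)) ≡ false
  exceptional with a ≡ᵇ b + 3 in a≡
  ... | false = refl
  ... | true  =
    contradiction (subst (b + 4 ≤_) (≡ᵇ-true⇒≡ a≡) le) (ℕP.n≮n (b + 3) ∘ subst (_≤ b + 3) (ℕP.+-suc b 3))

SchurGap-offset : ∀ {x b z} → SchurGap x (b + z) → Σ ℕ λ a → x ≡ a + z × b + 3 ≤ a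
SchurGap-offset {x} {b} {z} (gap , _) = x ∸ z , sym (ℕP.m∸n+n≡m z≤x) , b+3≤x∸z
  where
  gap′ : b + 3 + z ≤ x
  gap′ = subst (_≤ x) (+-shift-3 b z) gap
  z≤x : z ≤ x
  z≤x = ℕP.≤-trans (ℕP.m≤n+m z (b + 3)) gap′
  b+3≤x∸z : b + 3 ≤ x ∸ z
  b+3≤x∸z = subst (_≤ x ∸ z) (ℕP.m+n∸n≡m (b + 3) z) (ℕP.∸-monoˡ-≤ z gap′)

-- The maps φ and ψ

-- φ π = (σ , c) places σ in 𝒟(m − k, n − 2m + k) with k = tailWeight c.
data Tail : Set where
  tail₀ tail₁ tail₂ : Tail

tailWeight : Tail → ℕ
tailWeight tail₀ = 0
tailWeight tail₁ = 1
tailWeight tail₂ = 2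

tailParts : Tail → List ℕ
tailParts tail₀ = []
tailParts tail₁ = 1 ∷ []
tailParts tail₂ = 2 ∷ []

Σ-Tail↔⊎ : (F : Tail → Set) → Σ Tail F ↔ (F tail₀ ⊎ (F tail₁ ⊎ F tail₂))
Σ-Tail↔⊎ F = mk↔ₛ′ to from to∘from from∘to
  where
  to : Σ Tail F → F tail₀ ⊎ (F tail₁ ⊎ F tail₂)
  to (tail₀ , x) = inj₁ x
  to (tail₁ , x) = inj₂ (inj₁ x)
  to (tail₂ , x) = inj₂ (inj₂ x)
  from : F tail₀ ⊎ (F tail₁ ⊎ F tail₂) → Σ Tail F
  from (inj₁ x)        = tail₀ , x
  from (inj₂ (inj₁ x)) = tail₁ , x
  from (inj₂ (inj₂ x)) = tail₂ , x
  to∘from : ∀ y → to (from y) ≡ y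
  to∘from (inj₁ _)        = refl
  to∘from (inj₂ (inj₁ _)) = refl
  to∘from (inj₂ (inj₂ _)) = refl
  from∘to : ∀ x → from (to x) ≡ x
  from∘to (tail₀ , _) = refl
  from∘to (tail₁ , _) = refl
  from∘to (tail₂ , _) = refl

φ-last : ℕ → List ℕ × Tail
φ-last 1 = [] , tail₁
φ-last 2 = [] , tail₂
φ-last 4 = 1 ∷ [] , tail₁
φ-last x = lower x ∷ [] , tail₀

φ-cons : (x y : ℕ) (isPair isOne : Bool) (φ[y∷zs] φ[zs] : List ℕ × Tail) → List ℕ × Tail
φ-cons x y false _     φ[y∷zs] _     = map₁ (lower x ∷_) φ[y∷zs]
φ-cons x y true  false _       φ[zs] = map₁ (λ σ → x ∸ 3 ∷ y ∸ 3 ∷ σ) φ[zs]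
φ-cons x y true  true  _       _     = x ∸ 3 ∷ [] , tail₂

φ : List ℕ → List ℕ × Tail
φ []           = [] , tail₀
φ (x ∷ [])     = φ-last x
φ (x ∷ y ∷ zs) = φ-cons x y (evenOddPairᵇ x y) (y ≡ᵇ 1) (φ (y ∷ zs)) (φ zs)

ψ-last : Tail → ℕ → List ℕ
ψ-last tail₀ 1 = 3 ∷ []
ψ-last tail₁ 1 = 4 ∷ []
ψ-last tail₂ 1 = 4 ∷ 1 ∷ []
ψ-last c     s = raise s ∷ tailParts c

ψ-cons : (s t : ℕ) (isPair : Bool) (ψ[t∷ρ] ψ[ρ] : List ℕ) → List ℕ
ψ-cons s t false ψ[t∷ρ] _    = raise s ∷ ψ[t∷ρ]
ψ-cons s t true  _      ψ[ρ] = 3 + s ∷ 3 + t ∷ ψ[ρ]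

ψ : Tail → List ℕ → List ℕ
ψ c []          = tailParts c
ψ c (s ∷ [])    = ψ-last c s
ψ c (s ∷ t ∷ ρ) = ψ-cons s t (oddEvenPairᵇ s t) (ψ c (t ∷ ρ)) (ψ c ρ)

FitsAbove : ℕ → List ℕ → Set
FitsAbove h σ = Connected SchurGap (just h) (List.head σ)

NoEvenOddPair : ℕ → List ℕ → Set
NoEvenOddPair h []      = ⊤
NoEvenOddPair h (k ∷ _) = evenOddPairᵇ h k ≡ false

NoOddEvenPair : ℕ → List ℕ → Set
NoOddEvenPair h []      = ⊤
NoOddEvenPair h (k ∷ _) = oddEvenPairᵇ h k ≡ false

data LoweredHead : ℕ → List ℕ → Set where
  []ˡ      : ∀ {y} → LoweredHead y []
  odd-ˡ    : ∀ z {σ} → isEven z ≡ true → LoweredHead (3 + z) (1 + z ∷ σ)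
  even-ˡ   : ∀ z {σ} → isEven z ≡ true → LoweredHead (6 + z) (2 + z ∷ σ)
  paired-ˡ : ∀ z {σ} → isEven z ≡ true → isR0 (mod3 (4 + z)) ≡ false → LoweredHead (4 + z) (1 + z ∷ σ)

data RaisedHead : ℕ → List ℕ → Set where
  raised-ʳ : ∀ {t π} → RaisedHead t (raise t ∷ π)
  paired-ʳ : ∀ {t π} → isEven t ≡ false → isR0 (mod3 t) ≡ false → RaisedHead t (3 + t ∷ π)

lowerRel-≥ : ∀ a e → a ∸ 4 ≤ lowerRel a e
lowerRel-≥ a e with evenAfter a e
... | true  = ℕP.≤-refl
... | false = ℕP.∸-monoʳ-≤ a (s≤s (s≤s z≤n))

raiseRel-≥ : ∀ a e → 2 + a ≤ raiseRel a e
raiseRel-≥ a e with evenAfter a e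
... | true  = s≤s (s≤s (ℕP.m≤n+m a 2))
... | false = ℕP.≤-refl

-- x lies above the part b + z, whose image under φ starts with c + z.
module LoweredHeadCase (b c : ℕ) (offsetOK : Bool → Mod3 → Bool) (1≤b : 1 ≤ b) (c≤6 : c ≤ 6) where

  private
    before-lower : RelPred
    before-lower a e r = offsetOK e r ∧ (schurGapᵇ a b r ∧ not (evenOddPairRel a b e r))

    after-lower : RelPred
    after-lower a e r = schurGapᵇ (lowerRel a e) c r ∧ not (oddEvenPairRel (lowerRel a e) c e r)

    before-pair : RelPred
    before-pair a e r = offsetOK e r ∧ (not (evenAfter a e) ∧ (not (isR0 (next₃^ a r)) ∧ schurGapᵇ a b r))

    after-pair : RelPred
    after-pair a e r = schurGapᵇ (a ∸ 3) c r

  lower-fits : forAllBelow 16 (before-lower ⟶ᵇ after-lower) ≡ true →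
    ∀ x z → offsetOK (isEven z) (mod3 z) ≡ true → SchurGap x (b + z) → evenOddPairᵇ x (b + z) ≡ false →
    SchurGap (lower x) (c + z) × oddEvenPairᵇ (lower x) (c + z) ≡ false
  lower-fits small x z offset-z gap no-pair with SchurGap-offset {b = b} {z = z} gap
  ... | a , refl , b+3≤a rewrite lower-+ a z (ℕP.≤-trans (ℕP.+-monoˡ-≤ 3 1≤b) b+3≤a) =
    schurGapᵇ-sound (lowerRel a e) c z (∧-conicalˡ _ _ holds) ,
    trans (oddEvenPair-+ (lowerRel a e) c z) (not-true⇒false (∧-conicalʳ _ _ holds))
    where
    e = isEven z
    large : ∀ a e r → 16 ≤ a → before-lower a e r ≡ true → after-lower a e r ≡ true
    large a e r 16≤a _ = ∧-true (schurGapᵇ-large r (ℕP.≤-trans (ℕP.+-monoʳ-≤ c (ℕP.m≤m+n 4 2)) c+6≤lower))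
                                (false⇒not-true (oddEvenPairRel-large e r c+6≤lower))
      where
      c+6≤lower = ℕP.≤-trans (ℕP.+-monoˡ-≤ 6 c≤6) (ℕP.≤-trans (ℕP.∸-monoˡ-≤ 4 16≤a) (lowerRel-≥ a e))
    holds : after-lower a e (mod3 z) ≡ true
    holds = by-window before-lower after-lower small large a e (mod3 z)
              (∧-true offset-z (∧-true (schurGapᵇ-complete a b z gap)
                (false⇒not-true (trans (sym (evenOddPair-+ a b z)) no-pair))))

  pair-fits : forAllBelow 16 (before-pair ⟶ᵇ after-pair) ≡ true →
    ∀ y z → offsetOK (isEven z) (mod3 z) ≡ true → isEven y ≡ false → isR0 (mod3 y) ≡ false →
    SchurGap y (b + z) → SchurGap (y ∸ 3) (c + z)
  pair-fits small y z offset-z odd-y y≢0 gap with SchurGap-offset {b = b} {z = z} gap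
  ... | a , refl , b+3≤a rewrite ℕP.+-∸-comm z (ℕP.≤-trans (ℕP.m≤n+m 3 b) b+3≤a) =
    schurGapᵇ-sound (a ∸ 3) c z (by-window before-pair after-pair small large a (isEven z) (mod3 z)
      (∧-true offset-z (∧-true (false⇒not-true (trans (sym (isEven-+ a z)) odd-y))
        (∧-true (false⇒not-true (trans (cong isR0 (sym (mod3-+ a z))) y≢0)) (schurGapᵇ-complete a b z gap)))))
    where
    large : ∀ a e r → 16 ≤ a → before-pair a e r ≡ true → after-pair a e r ≡ true
    large a e r 16≤a _ =
      schurGapᵇ-large r (ℕP.≤-trans (ℕP.+-monoˡ-≤ 4 c≤6) (ℕP.≤-trans (ℕP.m≤m+n 10 3) (ℕP.∸-monoˡ-≤ 3 16≤a)))

even-offset : Bool → Mod3 → Bool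
even-offset e _ = e

even-offset-4+≢0 : Bool → Mod3 → Bool
even-offset-4+≢0 e r = e ∧ not (isR0 (next₃^ 4 r))

even-offset-4+≢0-holds : ∀ z → isEven z ≡ true → isR0 (mod3 (4 + z)) ≡ false →
                         even-offset-4+≢0 (isEven z) (mod3 z) ≡ true
even-offset-4+≢0-holds z even-z 4+z≢0 = ∧-true even-z (false⇒not-true (trans (cong isR0 (sym (mod3-+ 4 z))) 4+z≢0))

lower-fits-φ : ∀ {x y σ} → SchurGap x y → evenOddPairᵇ x y ≡ false → LoweredHead y σ →
               FitsAbove (lower x) σ × NoOddEvenPair (lower x) σ
lower-fits-φ     _   _       []ˡ = just-nothing , tt
lower-fits-φ {x} gap no-pair (odd-ˡ z even-z) =
  map₁ just (LoweredHeadCase.lower-fits 3 1 even-offset (s≤s z≤n) (s≤s z≤n) refl x z even-z gap no-pair)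
lower-fits-φ {x} gap no-pair (even-ˡ z even-z) =
  map₁ just (LoweredHeadCase.lower-fits 6 2 even-offset (s≤s z≤n) (s≤s (s≤s z≤n)) refl x z even-z gap no-pair)
lower-fits-φ {x} gap no-pair (paired-ˡ z even-z 4+z≢0) =
  map₁ just (LoweredHeadCase.lower-fits 4 1 even-offset-4+≢0 (s≤s z≤n) (s≤s z≤n) refl x z
    (even-offset-4+≢0-holds z even-z 4+z≢0) gap no-pair)

pair-fits-φ : ∀ {y y′ σ} → isEven y ≡ false → isR0 (mod3 y) ≡ false → SchurGap y y′ → LoweredHead y′ σ →
              FitsAbove (y ∸ 3) σ
pair-fits-φ     _     _   _   []ˡ = just-nothing
pair-fits-φ {y} odd-y y≢0 gap (odd-ˡ z even-z) =
  just (LoweredHeadCase.pair-fits 3 1 even-offset (s≤s z≤n) (s≤s z≤n) refl y z even-z odd-y y≢0 gap)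
pair-fits-φ {y} odd-y y≢0 gap (even-ˡ z even-z) =
  just (LoweredHeadCase.pair-fits 6 2 even-offset (s≤s z≤n) (s≤s (s≤s z≤n)) refl y z even-z odd-y y≢0 gap)
pair-fits-φ {y} odd-y y≢0 gap (paired-ˡ z even-z 4+z≢0) =
  just (LoweredHeadCase.pair-fits 4 1 even-offset-4+≢0 (s≤s z≤n) (s≤s z≤n) refl y z
    (even-offset-4+≢0-holds z even-z 4+z≢0) odd-y y≢0 gap)

-- s lies above the part t, whose image under ψ starts with c (isEven t) + t.
module RaisedHeadCase (c : Bool → ℕ) (offsetOK : Bool → Mod3 → Bool) (c≤12 : ∀ e → c e ≤ 12) where

  private
    before-raise : RelPred
    before-raise a e r = offsetOK e r ∧ (schurGapᵇ a 0 r ∧ not (oddEvenPairRel a 0 e r))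

    after-raise : RelPred
    after-raise a e r = schurGapᵇ (raiseRel a e) (c e) r ∧ not (evenOddPairRel (raiseRel a e) (c e) e r)

    before-pair : RelPred
    before-pair a e r = offsetOK e r ∧ (evenAfter a e ∧ (not (isR0 (next₃^ a r)) ∧ schurGapᵇ a 0 r))

    after-pair : RelPred
    after-pair a e r = schurGapᵇ (3 + a) (c e) r

  raise-fits : forAllBelow 16 (before-raise ⟶ᵇ after-raise) ≡ true →
    ∀ s t → offsetOK (isEven t) (mod3 t) ≡ true → SchurGap s t → oddEvenPairᵇ s t ≡ false →
    SchurGap (raise s) (c (isEven t) + t) × evenOddPairᵇ (raise s) (c (isEven t) + t) ≡ false
  raise-fits small s t offset-t gap no-pair with SchurGap-offset {b = 0} {z = t} gap
  ... | a , refl , _ rewrite raise-+ a t =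
    schurGapᵇ-sound (raiseRel a e) (c e) t (∧-conicalˡ _ _ holds) ,
    trans (evenOddPair-+ (raiseRel a e) (c e) t) (not-true⇒false (∧-conicalʳ _ _ holds))
    where
    e = isEven t
    large : ∀ a e r → 16 ≤ a → before-raise a e r ≡ true → after-raise a e r ≡ true
    large a e r 16≤a _ =
      ∧-true (schurGapᵇ-large r (ℕP.≤-trans (ℕP.+-monoʳ-≤ (c e) (ℕP.m≤m+n 4 2)) c+6≤raise))
                                (false⇒not-true (evenOddPairRel-large e r c+6≤raise))
      where
      c+6≤raise = ℕP.≤-trans (ℕP.+-monoˡ-≤ 6 (c≤12 e)) (ℕP.≤-trans (s≤s (s≤s 16≤a)) (raiseRel-≥ a e))
    holds : after-raise a e (mod3 t) ≡ true
    holds = by-window before-raise after-raise small large a e (mod3 t)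
              (∧-true offset-t (∧-true (schurGapᵇ-complete a 0 t gap)
                (false⇒not-true (trans (sym (oddEvenPair-+ a 0 t)) no-pair))))

  pair-fits : forAllBelow 16 (before-pair ⟶ᵇ after-pair) ≡ true →
    ∀ t u → offsetOK (isEven u) (mod3 u) ≡ true → isEven t ≡ true → isR0 (mod3 t) ≡ false →
    SchurGap t u → SchurGap (3 + t) (c (isEven u) + u)
  pair-fits small t u offset-u even-t t≢0 gap with SchurGap-offset {b = 0} {z = u} gap
  ... | a , refl , _ =
    schurGapᵇ-sound (3 + a) (c (isEven u)) u (by-window before-pair after-pair small large a (isEven u) (mod3 u)
      (∧-true offset-u (∧-true (trans (sym (isEven-+ a u)) even-t)
        (∧-true (false⇒not-true (trans (cong isR0 (sym (mod3-+ a u))) t≢0)) (schurGapᵇ-complete a 0 u gap)))))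
    where
    large : ∀ a e r → 16 ≤ a → before-pair a e r ≡ true → after-pair a e r ≡ true
    large a e r 16≤a _ =
      schurGapᵇ-large r (ℕP.≤-trans (ℕP.+-monoˡ-≤ 4 (c≤12 e)) (ℕP.≤-trans 16≤a (ℕP.m≤n+m a 3)))

any-offset : Bool → Mod3 → Bool
any-offset _ _ = true

odd-nonmultiple-offset : Bool → Mod3 → Bool
odd-nonmultiple-offset e r = not e ∧ not (isR0 r)

raiseRel-0≤12 : ∀ e → raiseRel 0 e ≤ 12
raiseRel-0≤12 true  = ℕP.m≤m+n 4 8
raiseRel-0≤12 false = ℕP.m≤m+n 2 10

raise-fits-ψ : ∀ {s t π} → SchurGap s t → oddEvenPairᵇ s t ≡ false → RaisedHead t π →
               FitsAbove (raise s) π × NoEvenOddPair (raise s) π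
raise-fits-ψ {s} {t} gap no-pair raised-ʳ rewrite raise-+ 0 t =
  map₁ just (RaisedHeadCase.raise-fits (λ e → raiseRel 0 e) any-offset raiseRel-0≤12 refl s t refl gap no-pair)
raise-fits-ψ {s} {t} gap no-pair (paired-ʳ odd-t t≢0) =
  map₁ just (RaisedHeadCase.raise-fits (λ _ → 3) odd-nonmultiple-offset (λ _ → ℕP.m≤m+n 3 9) refl s t
    (∧-true (false⇒not-true odd-t) (false⇒not-true t≢0)) gap no-pair)

pair-fits-ψ : ∀ {t u π} → isEven t ≡ true → isR0 (mod3 t) ≡ false → SchurGap t u → RaisedHead u π →
              FitsAbove (3 + t) π
pair-fits-ψ {t} {u} even-t t≢0 gap raised-ʳ rewrite raise-+ 0 u =
  just (RaisedHeadCase.pair-fits (λ e → raiseRel 0 e) any-offset raiseRel-0≤12 refl t u refl even-t t≢0 gap)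
pair-fits-ψ {t} {u} even-t t≢0 gap (paired-ʳ odd-u u≢0) =
  just (RaisedHeadCase.pair-fits (λ _ → 3) odd-nonmultiple-offset (λ _ → ℕP.m≤m+n 3 9) refl t u
    (∧-true (false⇒not-true odd-u) (false⇒not-true u≢0)) even-t t≢0 gap)

evenOddPair⇒even : ∀ x y → evenOddPairᵇ x y ≡ true → isEven x ≡ true
evenOddPair⇒even x y pair = proj₁ (∧-true⁻ (isEven x) pair)

evenOddPair⇒odd : ∀ x y → evenOddPairᵇ x y ≡ true → isEven y ≡ false
evenOddPair⇒odd x y pair = not-true⇒false (proj₁ (∧-true⁻ (not (isEven y)) (proj₂ (∧-true⁻ (isEven x) pair))))

oddEvenPair⇒odd : ∀ s t → oddEvenPairᵇ s t ≡ true → isEven s ≡ false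
oddEvenPair⇒odd s t pair = not-true⇒false (proj₁ (∧-true⁻ (not (isEven s)) pair))

oddEvenPair⇒even : ∀ s t → oddEvenPairᵇ s t ≡ true → isEven t ≡ true
oddEvenPair⇒even s t pair = proj₁ (∧-true⁻ (isEven t) (proj₂ (∧-true⁻ (not (isEven s)) pair)))

record LoweredPair (x y : ℕ) : Set where
  field
    gap  : SchurGap (x ∸ 3) (y ∸ 3)
    pair : oddEvenPairᵇ (x ∸ 3) (y ∸ 3) ≡ true
    4≤y  : 4 ≤ y
    x≢0  : isR0 (mod3 x) ≡ false
    y≢0  : isR0 (mod3 y) ≡ false

next₃^3 : ∀ r → next₃^ 3 r ≡ r
next₃^3 r0 = refl
next₃^3 r1 = refl
next₃^3 r2 = refl

evenOddPair-lowered : ∀ {x y} → SchurGap x y → evenOddPairᵇ x y ≡ true → (y ≡ᵇ 1) ≡ false → LoweredPair x y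
evenOddPair-lowered {x} {0}         _   pair _ = contradiction (evenOddPair⇒odd x 0 pair) λ ()
evenOddPair-lowered {x} {1}         _   _    ()
evenOddPair-lowered {x} {2}         _   pair _ = contradiction (evenOddPair⇒odd x 2 pair) λ ()
evenOddPair-lowered {x} {suc (suc (suc w))} gap pair _ with SchurGap-offset {b = 3} {z = w} gap
... | a , refl , 6≤a = record
  { gap  = subst (λ v → SchurGap v w) (sym x∸3)
             (schurGapᵇ-sound (a ∸ 3) 0 w (holds (λ a _ r → schurGapᵇ (a ∸ 3) 0 r) refl))
  ; pair = subst (λ v → oddEvenPairᵇ v w ≡ true) (sym x∸3)
             (trans (oddEvenPair-+ (a ∸ 3) 0 w) (holds (λ a e r → oddEvenPairRel (a ∸ 3) 0 e r) refl))
  ; 4≤y  = s≤s (s≤s (s≤s (w≢0⇒1≤w w (holds (λ _ _ r → not (isR0 r)) refl))))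
  ; x≢0  = trans (cong isR0 (mod3-+ a w)) (not-true⇒false (holds (λ a _ r → not (isR0 (next₃^ a r))) refl))
  ; y≢0  = trans (cong isR0 (next₃^3 (mod3 w))) (not-true⇒false (holds (λ _ _ r → not (isR0 r)) refl))
  }
  where
  before : RelPred
  before a e r = schurGapᵇ a 3 r ∧ evenOddPairRel a 3 e r
  holds : ∀ after → forAllBelow 16 (before ⟶ᵇ after) ≡ true → after a (isEven w) (mod3 w) ≡ true
  holds after small = by-window before after small large a (isEven w) (mod3 w)
            (∧-true (schurGapᵇ-complete a 3 w gap) (trans (sym (evenOddPair-+ a 3 w)) pair))
    where
    large : ∀ a e r → 16 ≤ a → before a e r ≡ true → after a e r ≡ true
    large a e r 16≤a h = contradiction (trans (sym (proj₂ (∧-true⁻ (schurGapᵇ a 3 r) h)))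
                           (evenOddPairRel-large {a} {3} e r (ℕP.≤-trans (ℕP.m≤m+n 9 7) 16≤a))) λ ()
  x∸3 : (a + w) ∸ 3 ≡ (a ∸ 3) + w
  x∸3 = ℕP.+-∸-comm w (ℕP.≤-trans (ℕP.m≤m+n 3 3) 6≤a)
  w≢0⇒1≤w : ∀ w → not (isR0 (mod3 w)) ≡ true → 1 ≤ w
  w≢0⇒1≤w (suc _) _ = s≤s z≤n

record RaisedPair (s t : ℕ) : Set where
  field
    gap  : SchurGap (3 + s) (3 + t)
    pair : evenOddPairᵇ (3 + s) (3 + t) ≡ true
    s≢0  : isR0 (mod3 s) ≡ false
    t≢0  : isR0 (mod3 t) ≡ false

oddEvenPair-raised : ∀ {s t} → SchurGap s t → oddEvenPairᵇ s t ≡ true → RaisedPair s t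
oddEvenPair-raised {s} {t} gap pair with SchurGap-offset {b = 0} {z = t} gap
... | a , refl , _ = record
  { gap  = schurGapᵇ-sound (3 + a) 3 t (holds (λ a _ r → schurGapᵇ (3 + a) 3 r) refl)
  ; pair = trans (evenOddPair-+ (3 + a) 3 t) (holds (λ a e r → evenOddPairRel (3 + a) 3 e r) refl)
  ; s≢0  = trans (cong isR0 (mod3-+ a t)) (not-true⇒false (holds (λ a _ r → not (isR0 (next₃^ a r))) refl))
  ; t≢0  = not-true⇒false (holds (λ _ _ r → not (isR0 r)) refl)
  }
  where
  before : RelPred
  before a e r = schurGapᵇ a 0 r ∧ oddEvenPairRel a 0 e r
  holds : ∀ after → forAllBelow 16 (before ⟶ᵇ after) ≡ true → after a (isEven t) (mod3 t) ≡ true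
  holds after small = by-window before after small large a (isEven t) (mod3 t)
            (∧-true (schurGapᵇ-complete a 0 t gap) (trans (sym (oddEvenPair-+ a 0 t)) pair))
    where
    large : ∀ a e r → 16 ≤ a → before a e r ≡ true → after a e r ≡ true
    large a e r 16≤a h = contradiction (trans (sym (proj₂ (∧-true⁻ (schurGapᵇ a 0 r) h)))
                           (oddEvenPairRel-large {a} {0} e r (ℕP.≤-trans (ℕP.m≤m+n 6 10) 16≤a))) λ ()

lower-positive : ∀ {x} → 5 ≤ x → 1 ≤ lower x
lower-positive {x} 5≤x with isEven x
... | true  = ℕP.∸-monoˡ-≤ 4 5≤x
... | false = ℕP.≤-trans (ℕP.∸-monoˡ-≤ 4 5≤x) (ℕP.∸-monoʳ-≤ x (s≤s (s≤s z≤n)))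

lowered-head : ∀ {x} σ → 5 ≤ x → LoweredHead x (lower x ∷ σ)
lowered-head {1} σ (s≤s ())
lowered-head {2} σ (s≤s (s≤s ()))
lowered-head {suc (suc (suc z))} σ 5≤x with isEven z in even-z
... | true = odd-ˡ z even-z
lowered-head {suc (suc (suc zero))}                  σ 5≤x | false = contradiction even-z λ ()
lowered-head {suc (suc (suc (suc zero)))}            σ (s≤s (s≤s (s≤s (s≤s ())))) | false
lowered-head {suc (suc (suc (suc (suc zero))))}      σ 5≤x | false = contradiction even-z λ ()
lowered-head {suc (suc (suc (suc (suc (suc z)))))}   σ 5≤x | false with isEven z in even-z′
... | true  = even-ˡ z even-z′
... | false = contradiction even-z λ ()

paired-head : ∀ {x} σ → isEven x ≡ true → isR0 (mod3 x) ≡ false → 4 ≤ x → LoweredHead x (x ∸ 3 ∷ σ)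
paired-head {2} σ _ _ (s≤s (s≤s ()))
paired-head {suc (suc (suc (suc z)))} σ even-x x≢0 _ =
  paired-ˡ z (trans (sym (trans (not-involutive _) (not-involutive _))) even-x) x≢0

evenOddPair-below-5 : ∀ {x y} → SchurGap x y → 1 ≤ y → x < 5 → evenOddPairᵇ x y ≡ true
evenOddPair-below-5 {x} {y} (y+3≤x , _) 1≤y x<5
  with ℕP.≤-antisym (ℕP.≤-pred x<5) (ℕP.≤-trans (ℕP.+-monoˡ-≤ 3 1≤y) y+3≤x)
... | refl with ℕP.≤-antisym (ℕP.+-cancelʳ-≤ 3 y 1 y+3≤x) 1≤y
...   | refl = refl

no-evenOddPair⇒5≤ : ∀ {x y} → SchurGap x y → 1 ≤ y → evenOddPairᵇ x y ≡ false → 5 ≤ x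
no-evenOddPair⇒5≤ {x} gap 1≤y no-pair with 5 ℕP.≤? x
... | yes 5≤x = 5≤x
... | no 5≰x  = contradiction (trans (sym (evenOddPair-below-5 gap 1≤y (ℕP.≰⇒> 5≰x))) no-pair) λ ()

evenOddPair-1⇒4 : ∀ {x} → SchurGap x 1 → evenOddPairᵇ x 1 ≡ true → x ≡ 4
evenOddPair-1⇒4 {0} (() , _) _
evenOddPair-1⇒4 {1} (s≤s () , _) _
evenOddPair-1⇒4 {2} (s≤s (s≤s ()) , _) _
evenOddPair-1⇒4 {3} (s≤s (s≤s (s≤s ())) , _) _
evenOddPair-1⇒4 {4} _ _ = refl
evenOddPair-1⇒4 {5} _ ()
evenOddPair-1⇒4 {6} _ ()
evenOddPair-1⇒4 {suc (suc (suc (suc (suc (suc (suc x))))))} _ pair =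
  contradiction (trans (sym pair) (∧-zeroʳ (isEven (7 + x)))) λ ()

data φ-Step (x y : ℕ) (zs : List ℕ) : Set where
  lowered     : 5 ≤ x → evenOddPairᵇ x y ≡ false →
                φ (x ∷ y ∷ zs) ≡ map₁ (lower x ∷_) (φ (y ∷ zs)) → φ-Step x y zs
  paired      : evenOddPairᵇ x y ≡ true → LoweredPair x y →
                φ (x ∷ y ∷ zs) ≡ map₁ (λ σ → x ∸ 3 ∷ y ∸ 3 ∷ σ) (φ zs) → φ-Step x y zs
  paired-last : x ≡ 4 → y ≡ 1 → zs ≡ [] → φ-Step x y zs

φ-step : ∀ {x y zs} → IsSchur (x ∷ y ∷ zs) → φ-Step x y zs
φ-step {x} {y} {zs} (_ ∷ 1≤y ∷ _ , gap ∷ gaps) with evenOddPairᵇ x y in pair | y ≡ᵇ 1 in y≡1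
... | false | _     = lowered (no-evenOddPair⇒5≤ gap 1≤y pair) pair (cong (λ b → φ-cons′ b (y ≡ᵇ 1)) pair)
  where φ-cons′ = λ b c → φ-cons x y b c (φ (y ∷ zs)) (φ zs)
... | true  | false = paired pair (evenOddPair-lowered gap pair y≡1) (cong₂ φ-cons′ pair y≡1)
  where φ-cons′ = λ b c → φ-cons x y b c (φ (y ∷ zs)) (φ zs)
... | true  | true with refl ← ≡ᵇ-true⇒≡ {y} y≡1 =
  paired-last (evenOddPair-1⇒4 gap pair) refl (nothing-below-1 gaps)
  where
  nothing-below-1 : ∀ {zs} → Linked SchurGap (1 ∷ zs) → zs ≡ []
  nothing-below-1 [-] = refl
  nothing-below-1 {z ∷ _} ((z+3≤1 , _) ∷ _) = contradiction (ℕP.≤-trans (ℕP.m≤n+m 3 z) z+3≤1) λ { (s≤s ()) }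

LoweredHeadOf : List ℕ → List ℕ → Set
LoweredHeadOf []      σ = σ ≡ []
LoweredHeadOf (y ∷ _) σ = LoweredHead y σ

φ-last-valid : ∀ {x} → 1 ≤ x → IsSchur (proj₁ (φ-last x)) × LoweredHead x (proj₁ (φ-last x))
φ-last-valid {1} _ = ([] , []) , []ˡ
φ-last-valid {2} _ = ([] , []) , []ˡ
φ-last-valid {3} _ = (s≤s z≤n ∷ [] , [-]) , odd-ˡ 0 refl
φ-last-valid {4} _ = (s≤s z≤n ∷ [] , [-]) , paired-ˡ 0 refl refl
φ-last-valid {suc (suc (suc (suc (suc x))))} _ = (lower-positive 5≤5+x ∷ [] , [-]) , lowered-head [] 5≤5+x
  where 5≤5+x = ℕP.m≤m+n 5 x

pair-fits-φ-rest : ∀ {y zs σ} → isEven y ≡ false → isR0 (mod3 y) ≡ false → Linked SchurGap (y ∷ zs) →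
                   LoweredHeadOf zs σ → FitsAbove (y ∸ 3) σ
pair-fits-φ-rest {zs = []}    _     _   _         refl = just-nothing
pair-fits-φ-rest {zs = _ ∷ _} odd-y y≢0 (gap ∷ _) head = pair-fits-φ odd-y y≢0 gap head

PhiValid : List ℕ → Set
PhiValid π = IsSchur (proj₁ (φ π)) × LoweredHeadOf π (proj₁ (φ π))

φ-valid-cons : ∀ {x y zs} → IsSchur (x ∷ y ∷ zs) → PhiValid (y ∷ zs) → PhiValid zs → PhiValid (x ∷ y ∷ zs)
φ-valid-cons {x} {y} {zs} schur@(_ , gap ∷ gaps) ((positive , linked) , head) ((positive₂ , linked₂) , head₂)
  with φ-step schur
... | lowered 5≤x no-pair eq rewrite eq =
  (lower-positive 5≤x ∷ positive , proj₁ (lower-fits-φ gap no-pair head) ∷′ linked) , lowered-head _ 5≤x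
... | paired pair lp eq rewrite eq =
  ( ℕP.∸-monoˡ-≤ 3 4≤x ∷ ℕP.∸-monoˡ-≤ 3 (LoweredPair.4≤y lp) ∷ positive₂
  , LoweredPair.gap lp
      ∷ (pair-fits-φ-rest (evenOddPair⇒odd x y pair) (LoweredPair.y≢0 lp) gaps head₂ ∷′ linked₂))
  , paired-head _ (evenOddPair⇒even x y pair) (LoweredPair.x≢0 lp) 4≤x
  where
  4≤x : 4 ≤ x
  4≤x = ℕP.≤-trans (LoweredPair.4≤y lp) (ℕP.≤-trans (ℕP.m≤m+n y 3) (proj₁ gap))
... | paired-last refl refl refl = (s≤s z≤n ∷ [] , [-]) , paired-ˡ 0 refl refl

φ-valid : ∀ {π} → IsSchur π → PhiValid π
φ-valid {[]}         _                          = ([] , []) , refl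
φ-valid {x ∷ []}     (1≤x ∷ [] , _)             = φ-last-valid 1≤x
φ-valid {x ∷ y ∷ zs} schur@(_ ∷ pos , _ ∷ gaps) =
  φ-valid-cons schur (φ-valid (pos , gaps)) (φ-valid (All.tail pos , Linked.tail gaps))

¬3∣1 : ¬ 3 ∣ 1
¬3∣1 (divides (suc q) ())

¬3∣2 : ¬ 3 ∣ 2
¬3∣2 (divides (suc q) ())

SchurGap-1 : ∀ {h} → 4 ≤ h → SchurGap h 1
SchurGap-1 4≤h = 4≤h , λ (_ , _ , 3∣1) → ¬3∣1 3∣1

SchurGap-2 : ∀ {h} → 5 ≤ h → SchurGap h 2
SchurGap-2 5≤h = 5≤h , λ (_ , _ , 3∣2) → ¬3∣2 3∣2

tailParts-fits : ∀ c {h} → 5 ≤ h → FitsAbove h (tailParts c)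
tailParts-fits tail₀ _   = just-nothing
tailParts-fits tail₁ 5≤h = just (SchurGap-1 (ℕP.≤-trans (ℕP.n≤1+n 4) 5≤h))
tailParts-fits tail₂ 5≤h = just (SchurGap-2 5≤h)

tailParts-schur : ∀ c → IsSchur (tailParts c)
tailParts-schur tail₀ = [] , []
tailParts-schur tail₁ = s≤s z≤n ∷ [] , [-]
tailParts-schur tail₂ = s≤s z≤n ∷ [] , [-]

raise-≥ : ∀ s → 2 + s ≤ raise s
raise-≥ s with isEven s
... | true  = s≤s (s≤s (ℕP.m≤n+m s 2))
... | false = ℕP.≤-refl

raise-≥5 : ∀ {s} → 2 ≤ s → 5 ≤ raise s
raise-≥5 {1} (s≤s ())
raise-≥5 {2} _ = ℕP.m≤m+n 5 1
raise-≥5 {suc (suc (suc s))} _ = ℕP.≤-trans (s≤s (s≤s (s≤s (s≤s (s≤s z≤n))))) (raise-≥ (3 + s))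

ψ-last-raised : ∀ c s → IsSchur (raise (2 + s) ∷ tailParts c)
ψ-last-raised c s = ℕP.≤-trans (s≤s z≤n) (raise-≥5 {2 + s} (s≤s (s≤s z≤n))) ∷ proj₁ (tailParts-schur c)
                  , tailParts-fits c (raise-≥5 {2 + s} (s≤s (s≤s z≤n))) ∷′ proj₂ (tailParts-schur c)

ψ-last-valid : ∀ c {s} → 1 ≤ s → IsSchur (ψ-last c s) × RaisedHead s (ψ-last c s)
ψ-last-valid tail₀ {1} _ = (s≤s z≤n ∷ [] , [-]) , raised-ʳ
ψ-last-valid tail₁ {1} _ = (s≤s z≤n ∷ [] , [-]) , paired-ʳ refl refl
ψ-last-valid tail₂ {1} _ = (s≤s z≤n ∷ s≤s z≤n ∷ [] , SchurGap-1 ℕP.≤-refl ∷ [-]) , paired-ʳ refl refl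
ψ-last-valid tail₀ {suc (suc s)} _ = ψ-last-raised tail₀ s , raised-ʳ
ψ-last-valid tail₁ {suc (suc s)} _ = ψ-last-raised tail₁ s , raised-ʳ
ψ-last-valid tail₂ {suc (suc s)} _ = ψ-last-raised tail₂ s , raised-ʳ

data ψ-Step (c : Tail) (s t : ℕ) (ρ : List ℕ) : Set where
  raised : oddEvenPairᵇ s t ≡ false → ψ c (s ∷ t ∷ ρ) ≡ raise s ∷ ψ c (t ∷ ρ) → ψ-Step c s t ρ
  paired : oddEvenPairᵇ s t ≡ true → RaisedPair s t →
           ψ c (s ∷ t ∷ ρ) ≡ 3 + s ∷ 3 + t ∷ ψ c ρ → ψ-Step c s t ρ

ψ-step : ∀ c {s t ρ} → SchurGap s t → ψ-Step c s t ρ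
ψ-step c {s} {t} {ρ} gap with oddEvenPairᵇ s t in pair
... | false = raised pair (cong (λ b → ψ-cons s t b (ψ c (t ∷ ρ)) (ψ c ρ)) pair)
... | true  = paired pair (oddEvenPair-raised gap pair) (cong (λ b → ψ-cons s t b (ψ c (t ∷ ρ)) (ψ c ρ)) pair)

RaisedHeadOf : List ℕ → List ℕ → Set
RaisedHeadOf []      π = ⊤
RaisedHeadOf (t ∷ _) π = RaisedHead t π

PsiValid : Tail → List ℕ → Set
PsiValid c σ = IsSchur (ψ c σ) × RaisedHeadOf σ (ψ c σ)

pair-fits-ψ-rest : ∀ c {t ρ} → isEven t ≡ true → isR0 (mod3 t) ≡ false → 1 ≤ t → Linked SchurGap (t ∷ ρ) →
                   RaisedHeadOf ρ (ψ c ρ) → FitsAbove (3 + t) (ψ c ρ)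
pair-fits-ψ-rest c {t} {[]}    even-t _   1≤t _         _    =
  tailParts-fits c (s≤s (s≤s (s≤s (even⇒≥2 t even-t 1≤t))))
  where
  even⇒≥2 : ∀ t → isEven t ≡ true → 1 ≤ t → 2 ≤ t
  even⇒≥2 (suc (suc _)) _ _ = s≤s (s≤s z≤n)
pair-fits-ψ-rest c {ρ = _ ∷ _} even-t t≢0 _ (gap ∷ _) head = pair-fits-ψ even-t t≢0 gap head

ψ-valid-cons : ∀ c {s t ρ} → IsSchur (s ∷ t ∷ ρ) → PsiValid c (t ∷ ρ) → PsiValid c ρ → PsiValid c (s ∷ t ∷ ρ)
ψ-valid-cons c {s} {t} {ρ} (_ ∷ 1≤t ∷ _ , gap ∷ gaps)
  ((positive , linked) , head) ((positive₂ , linked₂) , head₂)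
  with ψ-step c {ρ = ρ} gap
... | raised no-pair eq rewrite eq =
  (ℕP.≤-trans (s≤s z≤n) (raise-≥ s) ∷ positive , proj₁ (raise-fits-ψ gap no-pair head) ∷′ linked) , raised-ʳ
... | paired pair rp eq rewrite eq =
  ( s≤s z≤n ∷ s≤s z≤n ∷ positive₂
  , RaisedPair.gap rp
      ∷ (pair-fits-ψ-rest c (oddEvenPair⇒even s t pair) (RaisedPair.t≢0 rp) 1≤t gaps head₂ ∷′ linked₂))
  , paired-ʳ (oddEvenPair⇒odd s t pair) (RaisedPair.s≢0 rp)

ψ-valid : ∀ c {σ} → IsSchur σ → PsiValid c σ
ψ-valid c {[]}        _                          = tailParts-schur c , _
ψ-valid c {s ∷ []}    (1≤s ∷ [] , _)             = ψ-last-valid c 1≤s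
ψ-valid c {s ∷ t ∷ ρ} schur@(_ ∷ pos , _ ∷ gaps) =
  ψ-valid-cons c schur (ψ-valid c (pos , gaps)) (ψ-valid c (All.tail pos , Linked.tail gaps))

-- φ and ψ are mutually inverse

lower-raise : ∀ s → lower (raise s) ≡ s
lower-raise s with isEven s in even-s
... | true  rewrite not-involutive (not (isEven s)) | not-involutive (isEven s) | even-s = refl
... | false rewrite not-involutive (isEven s) | even-s = refl

raise-lower : ∀ {x} → 5 ≤ x → raise (lower x) ≡ x
raise-lower {1} (s≤s ())
raise-lower {2} (s≤s (s≤s ()))
raise-lower {3} (s≤s (s≤s (s≤s ())))
raise-lower {suc (suc (suc (suc k)))} 5≤x with isEven k in even-k
... | true rewrite even-k = refl
raise-lower {suc (suc (suc (suc (suc k))))} 5≤x | false rewrite not-false⇒true even-k = refl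

lower-≥2 : ∀ {x} → 5 ≤ x → 2 ≤ lower x
lower-≥2 {x} 5≤x with lower x | raise-lower 5≤x
... | 0           | refl = contradiction 5≤x λ { (s≤s (s≤s (s≤s (s≤s ())))) }
... | 1           | refl = contradiction 5≤x λ { (s≤s (s≤s (s≤s ()))) }
... | suc (suc _) | _    = s≤s (s≤s z≤n)

ψ-raised-cons : ∀ c {h σ} → 2 ≤ h → NoOddEvenPair h σ → ψ c (h ∷ σ) ≡ raise h ∷ ψ c σ
ψ-raised-cons _     {1}           {[]} (s≤s ()) _
ψ-raised-cons tail₀ {suc (suc _)} {[]} _ _ = refl
ψ-raised-cons tail₁ {suc (suc _)} {[]} _ _ = refl
ψ-raised-cons tail₂ {suc (suc _)} {[]} _ _ = refl
ψ-raised-cons c {h} {k ∷ σ} _ no-pair = cong (λ b → ψ-cons h k b (ψ c (k ∷ σ)) (ψ c σ)) no-pair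

φ-lowered-cons : ∀ {h k π} → evenOddPairᵇ h k ≡ false → φ (h ∷ k ∷ π) ≡ map₁ (lower h ∷_) (φ (k ∷ π))
φ-lowered-cons {h} {k} {π} no-pair = cong (λ b → φ-cons h k b (k ≡ᵇ 1) (φ (k ∷ π)) (φ π)) no-pair

ψ∘φ : List ℕ → List ℕ
ψ∘φ π = ψ (proj₂ (φ π)) (proj₁ (φ π))

ψ∘φ-cons : ∀ {x y zs} → IsSchur (x ∷ y ∷ zs) → PhiValid (y ∷ zs) → ψ∘φ (y ∷ zs) ≡ y ∷ zs → ψ∘φ zs ≡ zs →
           ψ∘φ (x ∷ y ∷ zs) ≡ x ∷ y ∷ zs
ψ∘φ-cons {x} {y} {zs} schur@(_ , gap ∷ _) (_ , head) ih ih₂ with φ-step schur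
... | lowered 5≤x no-pair eq rewrite eq =
  trans (ψ-raised-cons (proj₂ (φ (y ∷ zs))) (lower-≥2 5≤x) (proj₂ (lower-fits-φ gap no-pair head)))
        (cong₂ _∷_ (raise-lower 5≤x) ih)
... | paired _ lp eq rewrite eq | LoweredPair.pair lp =
  cong₂ _∷_ (ℕP.m+[n∸m]≡n 3≤x) (cong₂ _∷_ (ℕP.m+[n∸m]≡n 3≤y) ih₂)
  where
  3≤y = ℕP.≤-trans (ℕP.n≤1+n 3) (LoweredPair.4≤y lp)
  3≤x = ℕP.≤-trans (ℕP.m≤n+m 3 y) (proj₁ gap)
... | paired-last refl refl refl = refl

ψ∘φ-id : ∀ {π} → IsSchur π → ψ∘φ π ≡ π
ψ∘φ-id {[]}         _ = refl
ψ∘φ-id {1 ∷ []}     _ = refl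
ψ∘φ-id {2 ∷ []}     _ = refl
ψ∘φ-id {3 ∷ []}     _ = refl
ψ∘φ-id {4 ∷ []}     _ = refl
ψ∘φ-id {suc (suc (suc (suc (suc x)))) ∷ []} _ =
  trans (ψ-raised-cons tail₀ {σ = []} (lower-≥2 5≤5+x) _) (cong (_∷ []) (raise-lower 5≤5+x))
  where 5≤5+x = ℕP.m≤m+n 5 x
ψ∘φ-id {x ∷ y ∷ zs} schur@(_ ∷ pos , _ ∷ gaps) =
  ψ∘φ-cons schur (φ-valid (pos , gaps)) (ψ∘φ-id (pos , gaps)) (ψ∘φ-id (All.tail pos , Linked.tail gaps))

φ-last-≥5 : ∀ {x} → 5 ≤ x → φ-last x ≡ (lower x ∷ [] , tail₀)
φ-last-≥5 {1} (s≤s ())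
φ-last-≥5 {2} (s≤s (s≤s ()))
φ-last-≥5 {3} (s≤s (s≤s (s≤s ())))
φ-last-≥5 {4} (s≤s (s≤s (s≤s (s≤s ()))))
φ-last-≥5 {suc (suc (suc (suc (suc x))))} _ = refl

evenOddPair-1-large : ∀ {h} → 5 ≤ h → evenOddPairᵇ h 1 ≡ false
evenOddPair-1-large {h} 5≤h with evenOddPairᵇ h 1 in pair
... | false = refl
... | true with refl ← evenOddPair-1⇒4 (SchurGap-1 (ℕP.≤-trans (ℕP.n≤1+n 4) 5≤h)) pair =
  contradiction 5≤h λ { (s≤s (s≤s (s≤s (s≤s ())))) }

evenOddPair-2≡false : ∀ h → evenOddPairᵇ h 2 ≡ false
evenOddPair-2≡false h = ∧-zeroʳ (isEven h)

φ-raised-last : ∀ c {s} → 2 ≤ s → φ (raise s ∷ tailParts c) ≡ (s ∷ [] , c)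
φ-raised-last tail₀ {s} 2≤s rewrite φ-last-≥5 (raise-≥5 2≤s) | lower-raise s = refl
φ-raised-last tail₁ {s} 2≤s rewrite evenOddPair-1-large (raise-≥5 2≤s) | lower-raise s = refl
φ-raised-last tail₂ {s} 2≤s rewrite evenOddPair-2≡false (raise s) | lower-raise s = refl

φ-lowered-cons-RaisedHead : ∀ {h t π} → RaisedHead t π → NoEvenOddPair h π →
                            φ (h ∷ π) ≡ map₁ (lower h ∷_) (φ π)
φ-lowered-cons-RaisedHead (raised-ʳ {π = π})       no-pair = φ-lowered-cons {π = π} no-pair
φ-lowered-cons-RaisedHead (paired-ʳ {π = π} _ _) no-pair = φ-lowered-cons {π = π} no-pair

φ∘ψ-cons : ∀ c {s t ρ} → IsSchur (s ∷ t ∷ ρ) → PsiValid c (t ∷ ρ) →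
           φ (ψ c (t ∷ ρ)) ≡ (t ∷ ρ , c) → φ (ψ c ρ) ≡ (ρ , c) →
           φ (ψ c (s ∷ t ∷ ρ)) ≡ (s ∷ t ∷ ρ , c)
φ∘ψ-cons c {s} {t} {ρ} (_ , gap ∷ _) (_ , head) ih ih₂ with ψ-step c {ρ = ρ} gap
... | raised no-pair eq rewrite eq =
  trans (φ-lowered-cons-RaisedHead head (proj₂ (raise-fits-ψ gap no-pair head)))
        (trans (cong (map₁ (lower (raise s) ∷_)) ih) (cong (λ h → h ∷ t ∷ ρ , c) (lower-raise s)))
... | paired _ rp eq rewrite eq | RaisedPair.pair rp | ih₂ = refl

φ∘ψ-id : ∀ c {σ} → IsSchur σ → φ (ψ c σ) ≡ (σ , c)
φ∘ψ-id tail₀ {[]}    _ = refl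
φ∘ψ-id tail₁ {[]}    _ = refl
φ∘ψ-id tail₂ {[]}    _ = refl
φ∘ψ-id tail₀ {1 ∷ []} _ = refl
φ∘ψ-id tail₁ {1 ∷ []} _ = refl
φ∘ψ-id tail₂ {1 ∷ []} _ = refl
φ∘ψ-id tail₀ {suc (suc s) ∷ []} _ = φ-raised-last tail₀ (s≤s (s≤s z≤n))
φ∘ψ-id tail₁ {suc (suc s) ∷ []} _ = φ-raised-last tail₁ (s≤s (s≤s z≤n))
φ∘ψ-id tail₂ {suc (suc s) ∷ []} _ = φ-raised-last tail₂ (s≤s (s≤s z≤n))
φ∘ψ-id c {s ∷ t ∷ ρ} schur@(_ ∷ pos , _ ∷ gaps) =
  φ∘ψ-cons c schur (ψ-valid c (pos , gaps)) (φ∘ψ-id c (pos , gaps)) (φ∘ψ-id c (All.tail pos , Linked.tail gaps))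

weight : ℕ → ℕ
weight x = if isEven x then 2 else 1

weights : List ℕ → ℕ
weights []      = 0
weights (x ∷ π) = weight x + weights π

mval≡weights : ∀ π → mval π ≡ weights π
mval≡weights []      = refl
mval≡weights (x ∷ π) with 2 ∣? x
... | yes 2∣x rewrite filter-accept (2 ∣?_) {x} {π} 2∣x | 2∣⇒isEven x 2∣x =
  cong suc (trans (ℕP.+-suc (length π) _) (cong suc (mval≡weights π)))
... | no 2∤x rewrite filter-reject (2 ∣?_) {x} {π} 2∤x with isEven x in even-x
...   | true  = contradiction (isEven⇒2∣ x even-x) 2∤x
...   | false = cong suc (mval≡weights π)

raise-weight : ∀ s → weight (raise s) ≡ weight s × raise s ≡ s + 2 * weight s
raise-weight s with isEven s in even-s
... | true  rewrite not-involutive (not (isEven s)) | not-involutive (isEven s) | even-s = refl , ℕP.+-comm 4 s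
... | false rewrite not-involutive (isEven s) | even-s = refl , ℕP.+-comm 2 s

lower-weight : ∀ {x} → 5 ≤ x → weight (lower x) ≡ weight x × lower x + 2 * weight x ≡ x
lower-weight {x} 5≤x = subst (λ x′ → weight s ≡ weight x′ × s + 2 * weight x′ ≡ x′) (raise-lower 5≤x)
  (sym same-weight , trans (cong (λ w → s + 2 * w) same-weight) (sym shift))
  where
  s = lower x
  same-weight = proj₁ (raise-weight s)
  shift = proj₂ (raise-weight s)

-- For image = (σ , c): weights σ = m − k and sum σ = n − 2m + k, where m = weights π,
-- n = sum π and k = tailWeight c, written without subtraction.
record WeightShift (π : List ℕ) (image : List ℕ × Tail) : Set where
  constructor _,_
  field
    weights≡ : weights (proj₁ image) + tailWeight (proj₂ image) ≡ weights π
    sum≡     : sum (proj₁ image) + 2 * weights π ≡ sum π + tailWeight (proj₂ image)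

lowered-weight : ∀ {x π σ c} → 5 ≤ x → WeightShift π (σ , c) → WeightShift (x ∷ π) (lower x ∷ σ , c)
lowered-weight {x} {π} {σ} {c} 5≤x (same , shift) =
  trans (ℕP.+-assoc (weight (lower x)) (weights σ) (tailWeight c)) (cong₂ _+_ (proj₁ lw) same) ,
  trans (regroup (lower x) (sum σ) (weight x) (weights π))
        (trans (cong₂ _+_ (proj₂ lw) shift) (sym (ℕP.+-assoc x (sum π) (tailWeight c))))
  where
  lw = lower-weight 5≤x
  regroup : ∀ a b p q → (a + b) + 2 * (p + q) ≡ (a + 2 * p) + (b + 2 * q)
  regroup = ℕ-Solver.solve-∀

weight-if : ∀ {x e} → isEven x ≡ e → weight x ≡ (if e then 2 else 1)
weight-if = cong (λ e → if e then 2 else 1)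

paired-weight : ∀ {x y zs σ c} → 3 ≤ x → 3 ≤ y → isEven x ≡ true → isEven y ≡ false → WeightShift zs (σ , c) →
                WeightShift (x ∷ y ∷ zs) (x ∸ 3 ∷ y ∸ 3 ∷ σ , c)
paired-weight {suc (suc (suc a))} {suc (suc (suc b))} {zs} {σ} {c}
  (s≤s (s≤s (s≤s _))) (s≤s (s≤s (s≤s _))) even-x odd-y (same , shift) = weights-eq , sum-eq
  where
  wa : weight a ≡ 1
  wa = weight-if {a} (not-true⇒false (trans (sym (isEven-3+ a)) even-x))
  wb : weight b ≡ 2
  wb = weight-if {b} (not-false⇒true (trans (sym (isEven-3+ b)) odd-y))
  weights-eq : weight a + (weight b + weights σ) + tailWeight c ≡ weight (3 + a) + (weight (3 + b) + weights zs)
  weights-eq rewrite wa | wb | weight-if {3 + a} even-x | weight-if {3 + b} odd-y = cong (_+_ 3) same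
  sum-eq : a + (b + sum σ) + 2 * (weight (3 + a) + (weight (3 + b) + weights zs)) ≡ 3 + a + (3 + b + sum zs) + tailWeight c
  sum-eq rewrite weight-if {3 + a} even-x | weight-if {3 + b} odd-y =
    trans (regroup a b (sum σ) (weights zs)) (trans (cong (_+_ (6 + a + b)) shift) (regroup′ a b (sum zs) (tailWeight c)))
    where
    regroup : ∀ a b s w → a + (b + s) + 2 * (2 + (1 + w)) ≡ 6 + a + b + (s + 2 * w)
    regroup = ℕ-Solver.solve-∀
    regroup′ : ∀ a b s c → 6 + a + b + (s + c) ≡ 3 + a + (3 + b + s) + c
    regroup′ = ℕ-Solver.solve-∀

φ-last-weight : ∀ {x} → 1 ≤ x → WeightShift (x ∷ []) (φ-last x)
φ-last-weight {1} _ = refl , refl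
φ-last-weight {2} _ = refl , refl
φ-last-weight {3} _ = refl , refl
φ-last-weight {4} _ = refl , refl
φ-last-weight {x@(suc (suc (suc (suc (suc k)))))} _ = lowered-weight {x} {[]} {[]} {tail₀} (ℕP.m≤m+n 5 k) (refl , refl)

φ-weight-cons : ∀ {x y zs} → IsSchur (x ∷ y ∷ zs) → WeightShift (y ∷ zs) (φ (y ∷ zs)) → WeightShift zs (φ zs) →
                WeightShift (x ∷ y ∷ zs) (φ (x ∷ y ∷ zs))
φ-weight-cons {x} {y} schur@(_ , gap ∷ _) ih ih₂ with φ-step schur
... | lowered 5≤x _ eq rewrite eq = lowered-weight 5≤x ih
... | paired pair lp eq rewrite eq =
  paired-weight (ℕP.≤-trans (ℕP.m≤n+m 3 y) (proj₁ gap)) (ℕP.≤-trans (ℕP.n≤1+n 3) (LoweredPair.4≤y lp))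
                (evenOddPair⇒even x y pair) (evenOddPair⇒odd x y pair) ih₂
... | paired-last refl refl refl = refl , refl

φ-weight : ∀ {π} → IsSchur π → WeightShift π (φ π)
φ-weight {[]}         _              = refl , refl
φ-weight {x ∷ []}     (1≤x ∷ [] , _) = φ-last-weight 1≤x
φ-weight {x ∷ y ∷ zs} schur@(_ ∷ pos , _ ∷ gaps) =
  φ-weight-cons schur (φ-weight (pos , gaps)) (φ-weight (All.tail pos , Linked.tail gaps))

odd<even : ∀ {x M} → isEven x ≡ false → isEven M ≡ true → x ≤ M → x < M
odd<even odd-x even-M x≤M = ℕP.≤∧≢⇒< x≤M λ { refl → contradiction (trans (sym odd-x) even-M) λ () }

raise≤ : ∀ {s M} → isEven M ≡ true → s + 3 ≤ M → raise s ≤ M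
raise≤ {s} {M} even-M s+3≤M with isEven s in even-s
... | true  = subst (_≤ M) (cong suc (ℕP.+-comm s 3)) (odd<even odd-s+3 even-M s+3≤M)
  where
  odd-s+3 : isEven (s + 3) ≡ false
  odd-s+3 = trans (cong isEven (ℕP.+-comm s 3)) (trans (isEven-3+ s) (cong not even-s))
... | false = ℕP.≤-trans (ℕP.≤-reflexive (ℕP.+-comm 2 s)) (ℕP.≤-trans (ℕP.+-monoʳ-≤ s (ℕP.n≤1+n 2)) s+3≤M)

raise≤⇒+3≤ : ∀ {s M} → isEven M ≡ true → raise s ≤ M → s + 3 ≤ M
raise≤⇒+3≤ {s} {M} even-M raise≤M with isEven s in even-s
... | true  = ℕP.≤-trans (ℕP.≤-trans (ℕP.≤-reflexive (ℕP.+-comm s 3)) (ℕP.n≤1+n (3 + s))) raise≤M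
... | false = subst (_≤ M) (ℕP.+-comm 3 s) (odd<even odd-2+s even-M raise≤M)
  where
  odd-2+s : isEven (2 + s) ≡ false
  odd-2+s = trans (not-involutive (isEven s)) even-s

lower+3≤ : ∀ {x M} → isEven M ≡ true → 5 ≤ x → x ≤ M → lower x + 3 ≤ M
lower+3≤ {x} {M} even-M 5≤x x≤M = raise≤⇒+3≤ even-M (subst (_≤ M) (sym (raise-lower 5≤x)) x≤M)

∸3+3≤ : ∀ {x M} → 3 ≤ x → x ≤ M → x ∸ 3 + 3 ≤ M
∸3+3≤ 3≤x x≤M = subst (_≤ _) (sym (ℕP.m∸n+n≡m 3≤x)) x≤M

PartsBelow : ℕ → List ℕ → Set
PartsBelow M = All (λ p → p + 3 ≤ M)

φ-bound-cons : ∀ {M x y zs} → isEven M ≡ true → IsSchur (x ∷ y ∷ zs) → All (_≤ M) (x ∷ y ∷ zs) →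
               PartsBelow M (proj₁ (φ (y ∷ zs))) → PartsBelow M (proj₁ (φ zs)) → PartsBelow M (proj₁ (φ (x ∷ y ∷ zs)))
φ-bound-cons {M} {x} {y} even-M schur@(_ , gap ∷ _) (x≤M ∷ y≤M ∷ _) ih ih₂ with φ-step schur
... | lowered 5≤x _ eq rewrite eq = lower+3≤ even-M 5≤x x≤M ∷ ih
... | paired _ lp eq rewrite eq =
  ∸3+3≤ (ℕP.≤-trans (ℕP.m≤n+m 3 y) (proj₁ gap)) x≤M
    ∷ ∸3+3≤ (ℕP.≤-trans (ℕP.n≤1+n 3) (LoweredPair.4≤y lp)) y≤M ∷ ih₂
... | paired-last refl refl refl = x≤M ∷ []

φ-bound : ∀ {M π} → isEven M ≡ true → IsSchur π → All (_≤ M) π → PartsBelow M (proj₁ (φ π))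
φ-bound {π = []}         _      _ _ = []
φ-bound {π = 1 ∷ []}     _      _ _ = []
φ-bound {π = 2 ∷ []}     _      _ _ = []
φ-bound {π = 3 ∷ []}     even-M _ (3≤M ∷ []) = odd<even refl even-M 3≤M ∷ []
φ-bound {π = 4 ∷ []}     _      _ (4≤M ∷ []) = 4≤M ∷ []
φ-bound {π = suc (suc (suc (suc (suc x)))) ∷ []} even-M _ (x≤M ∷ []) = lower+3≤ even-M (ℕP.m≤m+n 5 x) x≤M ∷ []
φ-bound {π = x ∷ y ∷ zs} even-M schur@(_ ∷ pos , _ ∷ gaps) bounded@(_ ∷ bounded′) =
  φ-bound-cons even-M schur bounded (φ-bound even-M (pos , gaps) bounded′)
    (φ-bound even-M (All.tail pos , Linked.tail gaps) (All.tail bounded′))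

tailParts-bound : ∀ c {M} → 2 ≤ M → All (_≤ M) (tailParts c)
tailParts-bound tail₀ _   = []
tailParts-bound tail₁ 2≤M = ℕP.≤-trans (ℕP.n≤1+n 1) 2≤M ∷ []
tailParts-bound tail₂ 2≤M = 2≤M ∷ []

ψ-bound-cons : ∀ c {M s t ρ} → isEven M ≡ true → IsSchur (s ∷ t ∷ ρ) → PartsBelow M (s ∷ t ∷ ρ) →
               All (_≤ M) (ψ c (t ∷ ρ)) → All (_≤ M) (ψ c ρ) → All (_≤ M) (ψ c (s ∷ t ∷ ρ))
ψ-bound-cons c {M} {s} {t} {ρ} even-M (_ , gap ∷ _) (s+3≤M ∷ t+3≤M ∷ _) ih ih₂ with ψ-step c {ρ = ρ} gap
... | raised _ eq rewrite eq = raise≤ even-M s+3≤M ∷ ih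
... | paired _ _ eq rewrite eq = subst (_≤ M) (ℕP.+-comm s 3) s+3≤M ∷ subst (_≤ M) (ℕP.+-comm t 3) t+3≤M ∷ ih₂

ψ-bound : ∀ c {M σ} → isEven M ≡ true → 2 ≤ M → IsSchur σ → PartsBelow M σ → All (_≤ M) (ψ c σ)
ψ-bound c     {σ = []}    _      2≤M _ _ = tailParts-bound c 2≤M
ψ-bound tail₀ {σ = 1 ∷ []} _     _   _ (4≤M ∷ []) = ℕP.≤-trans (ℕP.n≤1+n 3) 4≤M ∷ []
ψ-bound tail₁ {σ = 1 ∷ []} _     _   _ (4≤M ∷ []) = 4≤M ∷ []
ψ-bound tail₂ {σ = 1 ∷ []} _     _   _ (4≤M ∷ []) = 4≤M ∷ ℕP.≤-trans (s≤s z≤n) 4≤M ∷ []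
ψ-bound tail₀ {σ = suc (suc s) ∷ []} even-M 2≤M _ (s+3≤M ∷ []) =
  raise≤ even-M s+3≤M ∷ tailParts-bound tail₀ 2≤M
ψ-bound tail₁ {σ = suc (suc s) ∷ []} even-M 2≤M _ (s+3≤M ∷ []) =
  raise≤ even-M s+3≤M ∷ tailParts-bound tail₁ 2≤M
ψ-bound tail₂ {σ = suc (suc s) ∷ []} even-M 2≤M _ (s+3≤M ∷ []) =
  raise≤ even-M s+3≤M ∷ tailParts-bound tail₂ 2≤M
ψ-bound c {σ = s ∷ t ∷ ρ} even-M 2≤M schur@(_ ∷ pos , _ ∷ gaps) bounded@(_ ∷ bounded′) =
  ψ-bound-cons c even-M schur bounded (ψ-bound c even-M 2≤M (pos , gaps) bounded′)
    (ψ-bound c even-M 2≤M (All.tail pos , Linked.tail gaps) (All.tail bounded′))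

-- The bijection and its consequences

module Bijection (N : ℕ) (1≤N : 1 ≤ N) (m n : ℕ) where

  M : ℕ
  M = 2 * N

  mIndex : Tail → ℤ
  mIndex tail₀ = + m
  mIndex tail₁ = + m - + 1
  mIndex tail₂ = + m - + 2

  nIndex : Tail → ℤ
  nIndex tail₀ = + n - + (2 * m)
  nIndex tail₁ = + n - + (2 * m) ℤ.+ + 1
  nIndex tail₂ = + n - + (2 * m) ℤ.+ + 2

  mIndex⇔ : ∀ c w → (w + tailWeight c ≡ m) ⇔ (+ w ≡ mIndex c)
  mIndex⇔ tail₀ w = mk⇔ (λ eq → cong +_ (trans (sym (ℕP.+-identityʳ w)) eq))
                        (λ eq → trans (ℕP.+-identityʳ w) (ℤP.+-injective eq))
  mIndex⇔ tail₁ w = +≡-⇔ w 1 m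
  mIndex⇔ tail₂ w = +≡-⇔ w 2 m

  nIndex⇔ : ∀ c s → (s + 2 * m ≡ n + tailWeight c) ⇔ (+ s ≡ nIndex c)
  nIndex⇔ tail₀ s = mk⇔ (λ eq → Equivalence.to (+≡-⇔ s (2 * m) n) (trans eq (ℕP.+-identityʳ n)))
                        (λ eq → trans (Equivalence.from (+≡-⇔ s (2 * m) n) eq) (sym (ℕP.+-identityʳ n)))
  nIndex⇔ tail₁ s = +≡+-+⇔ s (2 * m) n 1
  nIndex⇔ tail₂ s = +≡+-+⇔ s (2 * m) n 2

  Target : Tail → Set
  Target c = 𝒟 (+ M - + 3) (mIndex c) (nIndex c)

  even-M : isEven M ≡ true
  even-M = 2∣⇒isEven M (divides N (ℕP.*-comm 2 N))

  2≤M : 2 ≤ M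
  2≤M = ℕP.*-monoʳ-≤ 2 1≤N

  InTarget : Tail → List ℕ → Set
  InTarget c = InD (+ M - + 3) (mIndex c) (nIndex c)

  φ-into : ∀ {π} → InD (+ M) (+ m) (+ n) π → InTarget (proj₂ (φ π)) (proj₁ (φ π))
  φ-into {π} (schur , bounded , sum≡n , mval≡m) =
    proj₁ (φ-valid schur) ,
    All.map (λ {p} → Equivalence.to (+≤-3⇔ p M)) (φ-bound even-M schur (All.map ℤP.drop‿+≤+ bounded)) ,
    Equivalence.to (nIndex⇔ c (sum σ)) sum-shift ,
    subst (λ w → + w ≡ mIndex c) (sym (mval≡weights σ))
      (Equivalence.to (mIndex⇔ c (weights σ)) (trans weights≡ weights≡m))
    where
    open WeightShift (φ-weight schur)
    σ = proj₁ (φ π)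
    c = proj₂ (φ π)
    weights≡m : weights π ≡ m
    weights≡m = trans (sym (mval≡weights π)) (ℤP.+-injective mval≡m)
    sum-shift : sum σ + 2 * m ≡ n + tailWeight c
    sum-shift = trans (cong (λ w → sum σ + 2 * w) (sym weights≡m))
                      (trans sum≡ (cong (_+ tailWeight c) (ℤP.+-injective sum≡n)))

  ψ-into : ∀ c {σ} → InTarget c σ → InD (+ M) (+ m) (+ n) (ψ c σ)
  ψ-into c {σ} (schur , bounded , sum≡nIndex , mval≡mIndex) =
    proj₁ (ψ-valid c schur) ,
    All.map +≤+ (ψ-bound c even-M 2≤M schur (All.map (λ {p} → Equivalence.from (+≤-3⇔ p M)) bounded)) ,
    cong +_ sum≡n ,
    cong +_ (trans (mval≡weights (ψ c σ)) weights≡m)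
    where
    shift : WeightShift (ψ c σ) (σ , c)
    shift = subst (WeightShift (ψ c σ)) (φ∘ψ-id c schur) (φ-weight (proj₁ (ψ-valid c schur)))
    open WeightShift shift
    weights≡m : weights (ψ c σ) ≡ m
    weights≡m = trans (sym weights≡)
      (Equivalence.from (mIndex⇔ c (weights σ)) (subst (λ w → + w ≡ mIndex c) (mval≡weights σ) mval≡mIndex))
    sum≡n : sum (ψ c σ) ≡ n
    sum≡n = ℕP.+-cancelʳ-≡ (tailWeight c) (sum (ψ c σ)) n
      (trans (sym sum≡) (trans (cong (λ w → sum σ + 2 * w) weights≡m)
        (Equivalence.from (nIndex⇔ c (sum σ)) sum≡nIndex)))

  Source : Set
  Source = 𝒟 (+ M) (+ m) (+ n)

  to : Source → Σ Tail Target
  to (π , t) = proj₂ (φ π) , proj₁ (φ π) , fromWitness (φ-into (toWitness t))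

  from : Σ Tail Target → Source
  from (c , σ , t) = ψ c σ , fromWitness (ψ-into c (toWitness t))

  from∘to : ∀ a → from (to a) ≡ a
  from∘to (π , t) = Σ-True-≡ (ψ∘φ-id (proj₁ (toWitness t))) _ t

  to∘from : ∀ b → to (from b) ≡ b
  to∘from (c , σ , t) = tagged-≡ (φ (ψ c σ)) _ (φ∘ψ-id c (proj₁ (toWitness t)))
    where
    tagged-≡ : ∀ image (w : True (inD? (+ M - + 3) (mIndex (proj₂ image)) (nIndex (proj₂ image)) (proj₁ image))) →
               image ≡ (σ , c) → _≡_ {A = Σ Tail Target} (proj₂ image , proj₁ image , w) (c , σ , t)
    tagged-≡ _ w refl = cong (λ w → c , σ , w) (T-irrelevant w t)

  Source↔Σ : Source ↔ Σ Tail Target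
  Source↔Σ = mk↔ₛ′ to from to∘from from∘to

  Source↔Targets : Source ↔ (Target tail₀ ⊎ (Target tail₁ ⊎ Target tail₂))
  Source↔Targets = Σ-Tail↔⊎ Target ↔-∘ Source↔Σ

  D-recurrence : D (+ M) (+ m) (+ n) ≡ D (+ M - + 3) (mIndex tail₀) (nIndex tail₀)
                                      + D (+ M - + 3) (mIndex tail₁) (nIndex tail₁)
                                      + D (+ M - + 3) (mIndex tail₂) (nIndex tail₂)
  D-recurrence = ↔⇒card≡ Source↔Targets (𝒟↔Fin-D _ _ _)
    (↔-sym (Fin-+³↔⊎ _ _ _) ↔-∘ (𝒟↔Fin-D _ _ _ ⊎-↔ (𝒟↔Fin-D _ _ _ ⊎-↔ 𝒟↔Fin-D _ _ _)))

theorem6 : (N : ℕ) → 1 ≤ N → (m n : ℕ) →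
    (𝒟 (+ (2 * N)) (+ m) (+ n) ⤖
      (𝒟 (+ (2 * N) - + 3) (+ m) (+ n - + (2 * m))
        ⊎ (𝒟 (+ (2 * N) - + 3) (+ m - + 1) (+ n - + (2 * m) ℤ.+ + 1)
        ⊎ 𝒟 (+ (2 * N) - + 3) (+ m - + 2) (+ n - + (2 * m) ℤ.+ + 2))))
    × (D (+ (2 * N)) (+ m) (+ n)
        ≡ D (+ (2 * N) - + 3) (+ m) (+ n - + (2 * m))
          + D (+ (2 * N) - + 3) (+ m - + 1) (+ n - + (2 * m) ℤ.+ + 1)
          + D (+ (2 * N) - + 3) (+ m - + 2) (+ n - + (2 * m) ℤ.+ + 2))
    × (d (+ (2 * N)) ≐ mul1+xq+x²q² (substXQ² (d (+ (2 * N) - + 3))))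
theorem6 N 1≤N m n =
  ↔⇒⤖ Source↔Targets ,
  D-recurrence ,
  d-≐-of-D-recurrence _ _ (λ m′ n′ → Bijection.D-recurrence N 1≤N m′ n′)
  where open Bijection N 1≤N m n
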